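{- Let $F$ be a tract and $\varphi:\mathcal T_n\cup\mathcal A_n\to F$ a weak restricted Grassmann--Plücker function. For a hyper-transversal $S$ let $X_S(i)=(-1)^{|S<i|}\varphi(S\setminus\{i\})$ for $i\in S$ and $X_S(i)=0$ otherwise. If $S_1,S_2$ are hyper-transversals such that $X_{S_1}$ and $X_{S_2}$ have the same support, then $X_{S_1}=\alpha X_{S_2}$ for some $\alpha\in F^\times$.
   Context: Tract: monoid $F=F^\times\sqcup\{0\}$ with null set $N_F$ of formal sums, $F\cap N_F=\{0\}$, unique $-1$ with $1+(-1)\in N_F$, $N_F$ closed under $F^\times$-scaling. Notation: $[n]^*=\{1^*,\dots,n^*\}$, $(i^*)^*=i$; $E=[n]\cup[n]^*$ ordered $1<1^*<\dots<n<n^*$; $|X<i|$ = number of elements of $X$ smaller than $i$; $[P]$ indicator. $\mathcal T_n$: transversals (exactly one of $i,i^*$ for each $i$); $\mathcal T_n^\sigma$: $|T\cap[n]^*|\equiv\sigma\pmod2$; $\mathcal A_n$: $n$-subsets with exactly one pair $\{i,i^*\}$; hyper-/hypo-transversal: transversal with one element added/removed. Antisymmetric matroid: $(E,\mathcal B)$ with $\emptyset\neq\mathcal B\subseteq\mathcal T_n\cup\mathcal A_n$ such that for every hyper-transversal $S$ and hypo-transversal $S'$ there are no or at least two $i\in S\setminus S'$ with $S\setminus\{i\},S'\cup\{i\}\in\mathcal B$, and for every transversal $T$ and distinct $i,j\in[n]$, $(T\setminus\{i,i^*\})\cup\{j,j^*\}\in\mathcal B$ iff $(T\cup\{i,i^*\})\setminus\{j,j^*\}\in\mathcal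 B$; even if $\mathcal B\cap\mathcal T_n\subseteq\mathcal T_n^\sigma$ for some $\sigma$. Weak restricted Grassmann--Plücker function: $\varphi$ whose support is the basis set of an even antisymmetric matroid, with (rGP2$'$) $\sum_{i\in S\setminus S'}(-1)^{|S\triangle S'<i|}\varphi(S\setminus\{i\})\varphi(S'\cup\{i\})\in N_F$ for every hyper-transversal $S$, hypo-transversal $S'$ with $|S\setminus S'|\le4$; (rGP3) some $\sigma$ with $\varphi=0$ on $\mathcal T_n^{1-\sigma}$; (rGP4) $\varphi((B\setminus\{i,i^*\})\cup\{j,j^*\})=(-1)^{[i\in B]+[j\in B]}\varphi((B\cup\{i,i^*\})\setminus\{j,j^*\})$ for $B\in\mathcal T_n^\sigma$, distinct $i,j\in[n]$. -}

module Defs where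

open import Data.Nat using (ℕ; zero; suc; _+_; _*_; _≤_; _<ᵇ_)
open import Data.Bool using (Bool; true; false; _∧_; not; _xor_; if_then_else_)
open import Data.Fin using (Fin; toℕ)
open import Data.Vec using (Vec; lookup; _[_]%=_; _[_]≔_; zipWith)
open import Data.Maybe using (Maybe; just; nothing)
open import Data.List using (List; []; _∷_; map; allFin; concatMap; catMaybes)
open import Data.Nat.ListAction using (sum)
open import Data.List.Relation.Binary.Permutation.Propositional using (_↭_)
open import Data.Product using (_×_; _,_; proj₁; proj₂; ∃; ∃-syntax)
open import Data.Sum using (_⊎_)
open import Relation.Nullary using (¬_)
open import Relation.Binary.PropositionalEquality using (_≡_; _≢_)

-- Tracts.  F = F^× ⊔ {0} is modelled as  Maybe U  (nothing = 0),
-- where U = F^× is an abelian group.  Formal sums (elements of ℕ[F^×])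
-- are lists of units, considered up to permutation.

record Tract : Set₁ where
  field
    U          : Set
    _·_        : U → U → U
    one        : U
    inv        : U → U
    ·-assoc    : ∀ x y z → (x · y) · z ≡ x · (y · z)
    ·-comm     : ∀ x y → x · y ≡ y · x
    ·-identityˡ : ∀ x → one · x ≡ x
    ·-inverseˡ : ∀ x → inv x · x ≡ one
    N          : List U → Set
    N-perm     : ∀ {xs ys} → xs ↭ ys → N xs → N ys
    N-zero     : N []
    N-unit     : ∀ x → ¬ N (x ∷ [])
    neg        : U
    neg-null   : N (one ∷ neg ∷ [])
    neg-unique : ∀ y → N (one ∷ y ∷ []) → y ≡ neg
    N-scale    : ∀ a xs → N xs → N (map (a ·_) xs)

module _ (F : Tract) where
  open Tract F

  Elt : Set
  Elt = Maybe U

  mulF : Elt → Elt → Elt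
  mulF (just x) (just y) = just (x · y)
  mulF _        _        = nothing

  scaleF : U → Elt → Elt
  scaleF a x = mulF (just a) x

  sgn : ℕ → Elt → Elt
  sgn zero    x = x
  sgn (suc k) x = scaleF neg (sgn k x)

  formal : List Elt → List U
  formal = catMaybes

-- The ground set E = [n] ∪ [n]^*.  An element is (i , s) with s = true
-- meaning i^*.  A subset of E is a vector whose i-th entry (a , b)
-- records whether i ∈ X (a) and whether i^* ∈ X (b).

El : ℕ → Set
El n = Fin n × Bool

Sub : ℕ → Set
Sub n = Vec (Bool × Bool) n

mem : ∀ {n} → El n → Sub n → Bool
mem (i , false) X = proj₁ (lookup X i)
mem (i , true)  X = proj₂ (lookup X i)

setMem : ∀ {n} → El n → Bool → Sub n → Sub n
setMem (i , false) v X = X [ i ]%= λ p → (v , proj₂ p)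
setMem (i , true)  v X = X [ i ]%= λ p → (proj₁ p , v)

insert : ∀ {n} → El n → Sub n → Sub n
insert e X = setMem e true X

remove : ∀ {n} → El n → Sub n → Sub n
remove e X = setMem e false X

-- all elements of E in the order 1 < 1^* < 2 < 2^* < ... < n < n^*
allEls : ∀ n → List (El n)
allEls n = concatMap (λ i → (i , false) ∷ (i , true) ∷ []) (allFin n)

rank : ∀ {n} → El n → ℕ
rank (i , s) = 2 * toℕ i + (if s then 1 else 0)

lt : ∀ {n} → El n → El n → Bool
lt e f = rank e <ᵇ rank f

countB : ∀ {n} → (El n → Bool) → ℕ
countB {n} p = sum (map (λ e → if p e then 1 else 0) (allEls n))

below : ∀ {n} → Sub n → El n → ℕ
below X e = countB (λ x → mem x X ∧ lt x e)

size : ∀ {n} → Sub n → ℕ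
size X = countB (λ x → mem x X)

starCount : ∀ {n} → Sub n → ℕ
starCount X = countB (λ x → proj₂ x ∧ mem x X)

odd : ℕ → Bool
odd zero    = false
odd (suc k) = not (odd k)

symDiff : ∀ {n} → Sub n → Sub n → Sub n
symDiff = zipWith (λ p q → (proj₁ p xor proj₁ q , proj₂ p xor proj₂ q))

inDiff : ∀ {n} → Sub n → Sub n → El n → Bool
inDiff S S' e = mem e S ∧ not (mem e S')

ind : Bool → ℕ
ind true  = 1
ind false = 0

IsTransversal : ∀ {n} → Sub n → Set
IsTransversal {n} T = ∀ (i : Fin n) → (lookup T i ≡ (true , false)) ⊎ (lookup T i ≡ (false , true))

-- T ∈ 𝒯_n^σ  (σ = true means odd)
InTσ : ∀ {n} → Bool → Sub n → Set
InTσ σ T = IsTransversal T × odd (starCount T) ≡ σ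

IsA : ∀ {n} → Sub n → Set
IsA {n} X = size X ≡ n × ∃[ j ] (lookup X j ≡ (true , true) × (∀ k → lookup X k ≡ (true , true) → k ≡ j))

IsHyper : ∀ {n} → Sub n → Set
IsHyper {n} S = ∃[ T ] ∃[ e ] (IsTransversal T × mem e T ≡ false × S ≡ insert e T)

IsHypo : ∀ {n} → Sub n → Set
IsHypo {n} S = ∃[ T ] ∃[ e ] (IsTransversal T × mem e T ≡ true × S ≡ remove e T)

swapOut : ∀ {n} → Sub n → Fin n → Fin n → Sub n
swapOut T i j = (T [ i ]≔ (false , false)) [ j ]≔ (true , true)

swapIn : ∀ {n} → Sub n → Fin n → Fin n → Sub n
swapIn T i j = (T [ i ]≔ (true , true)) [ j ]≔ (false , false)

record IsAntisymmetricMatroid (n : ℕ) (Bs : Sub n → Set) : Set where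
  field
    nonempty : ∃[ X ] Bs X
    bases⊆   : ∀ X → Bs X → IsTransversal X ⊎ IsA X
    -- no or at least two i ∈ S ∖ S' with S∖{i}, S'∪{i} ∈ ℬ
    exchange : ∀ S S' → IsHyper S → IsHypo S' →
               ∀ e → inDiff S S' e ≡ true → Bs (remove e S) → Bs (insert e S') →
               ∃[ f ] (f ≢ e × inDiff S S' f ≡ true × Bs (remove f S) × Bs (insert f S'))
    symmetry : ∀ T → IsTransversal T → ∀ i j → i ≢ j →
               (Bs (swapOut T i j) → Bs (swapIn T i j)) × (Bs (swapIn T i j) → Bs (swapOut T i j))

IsEvenAntisymmetricMatroid : (n : ℕ) → (Sub n → Set) → Set
IsEvenAntisymmetricMatroid n Bs =
  IsAntisymmetricMatroid n Bs × ∃[ σ ] (∀ X → Bs X → IsTransversal X → odd (starCount X) ≡ σ)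

-- Weak restricted Grassmann–Plücker functions.
-- φ is given as a total function on subsets of E; only its values on
-- 𝒯_n ∪ 𝒜_n are ever used.

module _ (F : Tract) where
  open Tract F

  Support : ∀ {n} → (Sub n → Elt F) → Sub n → Set
  Support φ X = (IsTransversal X ⊎ IsA X) × φ X ≢ nothing

  gpTerms : ∀ {n} → (Sub n → Elt F) → Sub n → Sub n → List U
  gpTerms {n} φ S S' = formal F (map term (allEls n))
    where
    term : El n → Elt F
    term e = if inDiff S S' e
             then sgn F (below (symDiff S S') e) (mulF F (φ (remove e S)) (φ (insert e S')))
             else nothing

  record IsWeakRestrictedGP (n : ℕ) (φ : Sub n → Elt F) : Set where
    field
      support-even : IsEvenAntisymmetricMatroid n (Support φ)
      rGP2′ : ∀ S S' → IsHyper S → IsHypo S' → countB (inDiff S S') ≤ 4 → N (gpTerms φ S S')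
      rGP34 : ∃[ σ ] ((∀ T → InTσ (not σ) T → φ T ≡ nothing) ×
                      (∀ B → InTσ σ B → ∀ i j → i ≢ j →
                         φ (swapOut B i j) ≡ sgn F (ind (mem (i , false) B) + ind (mem (j , false) B)) (φ (swapIn B i j))))

  Xvec : ∀ {n} → (Sub n → Elt F) → Sub n → El n → Elt F
  Xvec φ S e = if mem e S then sgn F (below S e) (φ (remove e S)) else nothing

module Submission where

-- For a hyper-transversal S with pair {j, j*}, the even matroid never supports both S ∖ {j} and
-- S ∖ {j*}, and symmetry plus exchange show that X_S vanishes unless it is nonzero on the pair.
-- If X_S vanishes on S ∖ R for a hyper-transversal R with |S ∖ R| ≤ 2, then (rGP2′) for S and
-- R ∖ {q, b} (q in the pair of R) has just two nonzero summands, of opposite signs, so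
-- X_S(q) X_R(b) = X_S(b) X_R(q) and X_S ∝ X_R.  Starting from S₁, symmetry moves the pair onto
-- that of S₂, and exchange then produces hyper-transversals agreeing with S₂ at ever more indices,
-- each proportional to the previous one, until S₂ itself is reached.

open import Defs
open import Level using (0ℓ)
open import Data.Nat using (ℕ; zero; suc; _+_; _*_; _≤_; _<_; _<ᵇ_; z≤n; s≤s)
open import Data.Nat.Properties
  using (≤-refl; ≤-trans; ≤-reflexive; ≤-antisym; <-irrefl; <-asym; +-mono-≤; ≮⇒≥; <ᵇ⇒<; <⇒<ᵇ;
         +-cancelʳ-≡; *-cancelˡ-≡; even≢odd; +-comm; +-identityʳ; +-suc)
open import Data.Nat.ListAction using (sum)
open import Data.Nat.Induction using (<-wellFounded)
open import Data.Bool using (Bool; true; false; _∧_; not; _xor_; if_then_else_)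
open import Data.Bool.Properties
  using (not-involutive; not-injective; not-¬; ¬-not; not-distribˡ-xor; ∧-zeroʳ; ∧-identityʳ; xor-∧-commutativeRing)
import Data.Bool.Properties as Bool
open import Data.Fin using (Fin; toℕ; zero; suc; _≟_)
import Data.Fin.Properties as Fin
open import Data.Maybe using (Maybe; just; nothing)
open import Data.Maybe.Properties using (just-injective)
open import Data.List using (List; []; _∷_; map; concatMap; tabulate; length; catMaybes; _++_)
open import Data.List.Properties using (map-∘; ++-identityʳ)
open import Data.List.Membership.Propositional using (_∈_)
open import Data.List.Relation.Unary.Any using (here; there)
open import Data.List.Relation.Binary.Permutation.Propositional
  using (_↭_; ↭-refl; ↭-trans; ↭-sym; swap; prep; module PermutationReasoning)
open import Data.List.Relation.Binary.Permutation.Propositional.Properties using (shift)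
open import Data.Vec using ([]; _∷_; lookup; _[_]≔_)
open import Data.Vec.Properties
  using (lookup∘updateAt; lookup∘updateAt′; lookup∘update; lookup∘update′; lookup-zipWith; tabulate∘lookup; tabulate-cong)
open import Data.Product using (Σ; _×_; _,_; proj₁; proj₂; ∃-syntax)
open import Data.Product.Properties using (≡-dec)
open import Data.Sum using (_⊎_; inj₁; inj₂)
open import Data.Empty using (⊥-elim)
open import Function using (_∘_; id)
open import Induction.WellFounded using (Acc; acc)
open import Relation.Nullary using (¬_; yes; no; does)
open import Relation.Nullary.Decidable using (toSum)
open import Relation.Binary.Definitions using (DecidableEquality)
open import Relation.Binary.PropositionalEquality
open import Algebra.Bundles using (AbelianGroup; CommutativeRing)
import Algebra.Properties.Group as GroupProperties
import Algebra.Properties.CommutativeSemigroup as CommutativeSemigroupProperties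

private
  variable
    n : ℕ

sucE : El n → El (suc n)
sucE (i , s) = (suc i , s)

sucE-injective : {e f : El n} → sucE e ≡ sucE f → e ≡ f
sucE-injective refl = refl

_≟E_ : DecidableEquality (El n)
_≟E_ = ≡-dec _≟_ Bool._≟_

true-or-false : ∀ b → b ≡ true ⊎ b ≡ false
true-or-false true  = inj₁ refl
true-or-false false = inj₂ refl

_without_ : (El n → Bool) → El n → El n → Bool
(p without y) e = p e ∧ not (does (e ≟E y))

without-at : ∀ (p : El n → Bool) y → (p without y) y ≡ false
without-at p y with y ≟E y
... | yes _  = ∧-zeroʳ (p y)
... | no y≢y = ⊥-elim (y≢y refl)

without-off : ∀ (p : El n → Bool) {y e} → e ≢ y → (p without y) e ≡ p e
without-off p {y} {e} e≢y with e ≟E y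
... | yes e≡y = ⊥-elim (e≢y e≡y)
... | no _    = ∧-identityʳ (p e)

odd-+ : ∀ m k → odd (m + k) ≡ odd m xor odd k
odd-+ zero    k = refl
odd-+ (suc m) k = trans (cong not (odd-+ m k)) (not-distribˡ-xor (odd m) (odd k))

odd-ind : ∀ b → odd (ind b) ≡ b
odd-ind false = refl
odd-ind true  = refl

module XorProperties = CommutativeSemigroupProperties (CommutativeRing.+-commutativeSemigroup xor-∧-commutativeRing)

xor-interchange : ∀ a b c d → (a xor b) xor (c xor d) ≡ (a xor c) xor (b xor d)
xor-interchange = XorProperties.interchange

xor-rotate : ∀ a b c → a xor (b xor c) ≡ c xor (b xor a)
xor-rotate = XorProperties.x∙yz≈z∙yx

-- Counting over E

countIn : List (El n) → (El n → Bool) → ℕ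
countIn xs p = sum (map (λ e → if p e then 1 else 0) xs)

countIn-cong : ∀ (xs : List (El n)) {p q} → (∀ e → p e ≡ q e) → countIn xs p ≡ countIn xs q
countIn-cong []       h = refl
countIn-cong (x ∷ xs) h = cong₂ _+_ (cong (λ b → if b then 1 else 0) (h x)) (countIn-cong xs h)

countIn-mono : ∀ (xs : List (El n)) {p q} → (∀ e → p e ≡ true → q e ≡ true) → countIn xs p ≤ countIn xs q
countIn-mono []       h = z≤n
countIn-mono (x ∷ xs) {p} {q} h = +-mono-≤ (indicator-mono (h x)) (countIn-mono xs h)
  where
  indicator-mono : ∀ {a b : Bool} → (a ≡ true → b ≡ true) → (if a then 1 else 0) ≤ (if b then 1 else 0)
  indicator-mono {false}         _  = z≤n
  indicator-mono {true}  {false} ab with () ← ab refl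
  indicator-mono {true}  {true}  _  = ≤-refl

odd-countIn-xor : ∀ (xs : List (El n)) (p q : El n → Bool) →
                  odd (countIn xs (λ e → p e xor q e)) ≡ odd (countIn xs p) xor odd (countIn xs q)
odd-countIn-xor []       p q = refl
odd-countIn-xor (x ∷ xs) p q = begin
  odd (ind′ (p x xor q x) + countIn xs (λ e → p e xor q e))
    ≡⟨ odd-ind′-+ (p x xor q x) _ ⟩
  (p x xor q x) xor odd (countIn xs (λ e → p e xor q e))
    ≡⟨ cong ((p x xor q x) xor_) (odd-countIn-xor xs p q) ⟩
  (p x xor q x) xor (odd (countIn xs p) xor odd (countIn xs q))
    ≡⟨ xor-interchange (p x) (q x) _ _ ⟩
  (p x xor odd (countIn xs p)) xor (q x xor odd (countIn xs q))
    ≡⟨ sym (cong₂ _xor_ (odd-ind′-+ (p x) _) (odd-ind′-+ (q x) _)) ⟩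
  odd (ind′ (p x) + countIn xs p) xor odd (ind′ (q x) + countIn xs q) ∎
  where
  open ≡-Reasoning
  ind′ : Bool → ℕ
  ind′ b = if b then 1 else 0
  odd-ind′-+ : ∀ b m → odd (ind′ b + m) ≡ b xor odd m
  odd-ind′-+ false m = refl
  odd-ind′-+ true  m = refl

countIn-split : ∀ (xs : List (El n)) (p r : El n → Bool) →
                countIn xs p ≡ countIn xs (λ e → p e ∧ r e) + countIn xs (λ e → p e ∧ not (r e))
countIn-split []       p r = refl
countIn-split (x ∷ xs) p r with p x | r x
... | false | _     = countIn-split xs p r
... | true  | true  = cong suc (countIn-split xs p r)
... | true  | false = trans (cong suc (countIn-split xs p r)) (sym (+-suc _ _))

countIn-none : ∀ (xs : List (El n)) {p} → (∀ e → p e ≡ false) → countIn xs p ≡ 0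
countIn-none []       h = refl
countIn-none (x ∷ xs) h rewrite h x = countIn-none xs h

countIn-map : ∀ (xs : List (El n)) (p : El (suc n) → Bool) → countIn (map sucE xs) p ≡ countIn xs (p ∘ sucE)
countIn-map []       p = refl
countIn-map (x ∷ xs) p = cong (_ +_) (countIn-map xs p)

allEls-suc : allEls (suc n) ≡ (zero , false) ∷ (zero , true) ∷ map sucE (allEls n)
allEls-suc {n} = cong (λ es → (zero , false) ∷ (zero , true) ∷ es) (tabulate-suc id)
  where
  sides : ∀ {m} → Fin m → List (El m)
  sides i = (i , false) ∷ (i , true) ∷ []
  tabulate-suc : ∀ {k} (f : Fin k → Fin n) →
          concatMap sides (tabulate (suc ∘ f)) ≡ map sucE (concatMap sides (tabulate f))
  tabulate-suc {zero}  f = refl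
  tabulate-suc {suc k} f = cong (λ es → (suc (f zero) , false) ∷ (suc (f zero) , true) ∷ es) (tabulate-suc (f ∘ suc))

if-ind : ∀ b → (if b then 1 else 0) ≡ ind b
if-ind false = refl
if-ind true  = refl

countB-suc : ∀ (p : El (suc n) → Bool) →
             countB p ≡ ind (p (zero , false)) + (ind (p (zero , true)) + countB (p ∘ sucE))
countB-suc {n} p = begin
  countIn (allEls (suc n)) p
    ≡⟨ cong (λ es → countIn es p) allEls-suc ⟩
  (if p (zero , false) then 1 else 0) + ((if p (zero , true) then 1 else 0) + countIn (map sucE (allEls n)) p)
    ≡⟨ cong₂ _+_ (if-ind (p (zero , false))) (cong₂ _+_ (if-ind (p (zero , true))) (countIn-map (allEls n) p)) ⟩
  ind (p (zero , false)) + (ind (p (zero , true)) + countB (p ∘ sucE)) ∎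
  where open ≡-Reasoning

countB-point : ∀ {p : El n → Bool} y → (∀ e → e ≢ y → p e ≡ false) → countB p ≡ ind (p y)
countB-point {suc n} {p} (zero , false) h
  rewrite countB-suc p | h (zero , true) (λ ()) | countIn-none (allEls n) (λ e → h (sucE e) (λ ()))
  = +-identityʳ _
countB-point {suc n} {p} (zero , true) h
  rewrite countB-suc p | h (zero , false) (λ ()) | countIn-none (allEls n) (λ e → h (sucE e) (λ ()))
  = +-identityʳ _
countB-point {suc n} {p} (suc i , s) h
  rewrite countB-suc p | h (zero , false) (λ ()) | h (zero , true) (λ ())
  = countB-point (i , s) (λ e e≢y → h (sucE e) (e≢y ∘ sucE-injective))

countB-remove-point : ∀ (p : El n → Bool) y → countB p ≡ ind (p y) + countB (p without y)
countB-remove-point {n} p y = begin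
  countB p
    ≡⟨ countIn-split (allEls n) p (λ e → does (e ≟E y)) ⟩
  countB (λ e → p e ∧ does (e ≟E y)) + countB (p without y)
    ≡⟨ cong (_+ countB (p without y)) (countB-point y off-y) ⟩
  ind (p y ∧ does (y ≟E y)) + countB (p without y)
    ≡⟨ cong (λ b → ind (p y ∧ b) + countB (p without y)) (same y) ⟩
  ind (p y ∧ true) + countB (p without y)
    ≡⟨ cong (λ b → ind b + countB (p without y)) (∧-identityʳ (p y)) ⟩
  ind (p y) + countB (p without y) ∎
  where
  open ≡-Reasoning
  same : ∀ e → does (e ≟E e) ≡ true
  same e with e ≟E e
  ... | yes _  = refl
  ... | no e≢e = ⊥-elim (e≢e refl)
  off-y : ∀ e → e ≢ y → (p e ∧ does (e ≟E y)) ≡ false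
  off-y e e≢y with e ≟E y
  ... | yes e≡y = ⊥-elim (e≢y e≡y)
  ... | no _    = ∧-zeroʳ (p e)

countB-< : ∀ {p q : El n → Bool} y → (∀ e → p e ≡ true → q e ≡ true) → p y ≡ false → q y ≡ true →
           countB p < countB q
countB-< {n} {p} {q} y p⊆q py qy = begin-strict
  countB p                        ≡⟨ countB-remove-point p y ⟩
  ind (p y) + countB (p without y) ≡⟨ cong (λ b → ind b + countB (p without y)) py ⟩
  countB (p without y)            <⟨ s≤s (countIn-mono (allEls n) without-mono) ⟩
  ind true + countB (q without y) ≡⟨ cong (λ b → ind b + countB (q without y)) (sym qy) ⟩
  ind (q y) + countB (q without y) ≡⟨ sym (countB-remove-point q y) ⟩
  countB q                        ∎
  where
  open Data.Nat.Properties.≤-Reasoning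
  without-mono : ∀ e → (p without y) e ≡ true → (q without y) e ≡ true
  without-mono e pe with toSum (e ≟E y)
  ... | inj₁ refl with () ← trans (sym (without-at p e)) pe
  ... | inj₂ e≢y  = trans (without-off q e≢y) (p⊆q e (trans (sym (without-off p e≢y)) pe))

countB-≤-length : ∀ {p : El n → Bool} ys → (∀ e → p e ≡ true → e ∈ ys) → countB p ≤ length ys
countB-≤-length {n} {p} [] p⊆ys = ≤-reflexive (countIn-none (allEls n) nowhere)
  where
  nowhere : ∀ e → p e ≡ false
  nowhere e with p e in pe
  ... | false = refl
  ... | true  with () ← p⊆ys e pe
countB-≤-length {n} {p} (y ∷ ys) p⊆ys = begin
  countB p                         ≡⟨ countB-remove-point p y ⟩
  ind (p y) + countB (p without y) ≤⟨ +-mono-≤ (ind≤1 (p y)) (countB-≤-length ys rest⊆ys) ⟩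
  suc (length ys)                  ∎
  where
  open Data.Nat.Properties.≤-Reasoning
  ind≤1 : ∀ b → ind b ≤ 1
  ind≤1 false = z≤n
  ind≤1 true  = ≤-refl
  rest⊆ys : ∀ e → (p without y) e ≡ true → e ∈ ys
  rest⊆ys e pe with toSum (e ≟E y)
  ... | inj₁ refl with () ← trans (sym pe) (without-at p e)
  ... | inj₂ e≢y with p⊆ys e (trans (sym (without-off p e≢y)) pe)
  ...   | here e≡y  = ⊥-elim (e≢y e≡y)
  ...   | there e∈ys = e∈ys

-- The order on E

double-injective : {i j : Fin n} → 2 * toℕ i ≡ 2 * toℕ j → i ≡ j
double-injective eq = Fin.toℕ-injective (*-cancelˡ-≡ _ _ 2 eq)

rank-injective : {e f : El n} → rank e ≡ rank f → e ≡ f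
rank-injective {e = i , false} {j , false} eq = cong (_, false) (double-injective (+-cancelʳ-≡ 0 _ _ eq))
rank-injective {e = i , true}  {j , true}  eq = cong (_, true) (double-injective (+-cancelʳ-≡ 1 _ _ eq))
rank-injective {e = i , false} {j , true}  eq =
  ⊥-elim (even≢odd (toℕ i) (toℕ j) (trans (sym (+-identityʳ _)) (trans eq (+-comm _ 1))))
rank-injective {e = i , true}  {j , false} eq =
  ⊥-elim (even≢odd (toℕ j) (toℕ i) (trans (sym (+-identityʳ _)) (trans (sym eq) (+-comm _ 1))))

<ᵇ-true⇒< : ∀ a b → (a <ᵇ b) ≡ true → a < b
<ᵇ-true⇒< a b eq = <ᵇ⇒< a b (subst Data.Bool.T (sym eq) _)

<ᵇ-false⇒≮ : ∀ a b → (a <ᵇ b) ≡ false → ¬ a < b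
<ᵇ-false⇒≮ a b eq a<b = subst Data.Bool.T eq (<⇒<ᵇ a<b)

<ᵇ-irrefl : ∀ a → (a <ᵇ a) ≡ false
<ᵇ-irrefl a with a <ᵇ a in eq
... | false = refl
... | true  = ⊥-elim (<-irrefl refl (<ᵇ-true⇒< a a eq))

<ᵇ-flip : ∀ {a b} → a ≢ b → (b <ᵇ a) ≡ not (a <ᵇ b)
<ᵇ-flip {a} {b} a≢b with a <ᵇ b in ab | b <ᵇ a in ba
... | true  | false = refl
... | false | true  = refl
... | true  | true  = ⊥-elim (<-asym (<ᵇ-true⇒< a b ab) (<ᵇ-true⇒< b a ba))
... | false | false = ⊥-elim (a≢b (≤-antisym (≮⇒≥ (<ᵇ-false⇒≮ b a ba)) (≮⇒≥ (<ᵇ-false⇒≮ a b ab))))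

lt-irrefl : (e : El n) → lt e e ≡ false
lt-irrefl e = <ᵇ-irrefl (rank e)

lt-flip : {e f : El n} → e ≢ f → lt f e ≡ not (lt e f)
lt-flip e≢f = <ᵇ-flip (e≢f ∘ rank-injective)

-- Subsets of E, one entry per index

Entry : Set
Entry = Bool × Bool

single : Bool → Entry
single false = (true , false)
single true  = (false , true)

both neither : Entry
both    = (true , true)
neither = (false , false)

IsSingle : Entry → Set
IsSingle p = p ≡ single false ⊎ p ≡ single true

side : Bool → Entry → Bool
side false = proj₁
side true  = proj₂

setSide : Bool → Bool → Entry → Entry
setSide false v (a , b) = (v , b)
setSide true  v (a , b) = (a , v)

side-single : ∀ s → side s (single s) ≡ true
side-single false = refl
side-single true  = refl

side-single-not : ∀ s → side s (single (not s)) ≡ false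
side-single-not false = refl
side-single-not true  = refl

side-single-true : ∀ {v} s → side v (single s) ≡ true → v ≡ s
side-single-true {false} false _  = refl
side-single-true {false} true  ()
side-single-true {true}  false ()
side-single-true {true}  true  _  = refl

side-single-false : ∀ {v} s → side v (single s) ≡ false → v ≡ not s
side-single-false {false} false ()
side-single-false {false} true  _  = refl
side-single-false {true}  false _  = refl
side-single-false {true}  true  ()

side-both : ∀ s → side s both ≡ true
side-both false = refl
side-both true  = refl

side-neither : ∀ s → side s neither ≡ false
side-neither false = refl
side-neither true  = refl

single-isSingle : ∀ s → IsSingle (single s)
single-isSingle false = inj₁ refl
single-isSingle true  = inj₂ refl

single-injective : ∀ {s t} → single s ≡ single t → s ≡ t
single-injective {false} {false} _ = refl
single-injective {true}  {true}  _ = refl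

single-not-≢ : ∀ s → single (not s) ≢ single s
single-not-≢ false ()
single-not-≢ true  ()

single-view : ∀ {p} → IsSingle p → ∃[ s ] p ≡ single s
single-view (inj₁ eq) = false , eq
single-view (inj₂ eq) = true , eq

single-by-side : ∀ {p} s → IsSingle p → side s p ≡ true → p ≡ single s
single-by-side false (inj₁ refl) _  = refl
single-by-side false (inj₂ refl) ()
single-by-side true  (inj₁ refl) ()
single-by-side true  (inj₂ refl) _  = refl

single-by-side-false : ∀ {p} s → IsSingle p → side s p ≡ false → p ≡ single (not s)
single-by-side-false false (inj₁ refl) ()
single-by-side-false false (inj₂ refl) _  = refl
single-by-side-false true  (inj₁ refl) _  = refl
single-by-side-false true  (inj₂ refl) ()

mem-lookup : ∀ (X : Sub n) i s → mem (i , s) X ≡ side s (lookup X i)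
mem-lookup X i false = refl
mem-lookup X i true  = refl

lookup-setMem : ∀ (X : Sub n) i s v → lookup (setMem (i , s) v X) i ≡ setSide s v (lookup X i)
lookup-setMem X i false v = lookup∘updateAt i X
lookup-setMem X i true  v = lookup∘updateAt i X

lookup-setMem-other : ∀ (X : Sub n) {i k} s v → k ≢ i → lookup (setMem (i , s) v X) k ≡ lookup X k
lookup-setMem-other X {i} {k} false v k≢i = lookup∘updateAt′ k i k≢i X
lookup-setMem-other X {i} {k} true  v k≢i = lookup∘updateAt′ k i k≢i X

lookup-≔ : ∀ (X : Sub n) i p → lookup (X [ i ]≔ p) i ≡ p
lookup-≔ X i p = lookup∘update i X p

lookup-≔-other : ∀ (X : Sub n) {i k} p → k ≢ i → lookup (X [ i ]≔ p) k ≡ lookup X k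
lookup-≔-other X p k≢i = lookup∘update′ k≢i X p

≡-by-lookup : {X Y : Sub n} → (∀ k → lookup X k ≡ lookup Y k) → X ≡ Y
≡-by-lookup {X = X} {Y} h = trans (sym (tabulate∘lookup X)) (trans (tabulate-cong h) (tabulate∘lookup Y))

≡-by-mem : {X Y : Sub n} → (∀ e → mem e X ≡ mem e Y) → X ≡ Y
≡-by-mem h = ≡-by-lookup (λ k → cong₂ _,_ (h (k , false)) (h (k , true)))

≡-or-differ : ∀ (X Y : Sub n) → X ≡ Y ⊎ ∃[ k ] lookup X k ≢ lookup Y k
≡-or-differ []      []      = inj₁ refl
≡-or-differ (p ∷ X) (q ∷ Y) with ≡-dec Bool._≟_ Bool._≟_ p q | ≡-or-differ X Y
... | no p≢q  | _               = inj₂ (zero , p≢q)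
... | yes p≡q | inj₁ X≡Y        = inj₁ (cong₂ _∷_ p≡q X≡Y)
... | yes _   | inj₂ (k , differ) = inj₂ (suc k , differ)

mem-setMem : ∀ (X : Sub n) y v → mem y (setMem y v X) ≡ v
mem-setMem X (i , false) v = cong proj₁ (lookup∘updateAt i X)
mem-setMem X (i , true)  v = cong proj₂ (lookup∘updateAt i X)

mem-setMem-other : ∀ (X : Sub n) {x y} v → x ≢ y → mem x (setMem y v X) ≡ mem x X
mem-setMem-other X {i , s} {j , t} v x≢y with i Fin.≟ j
... | no i≢j = trans (mem-lookup _ i s) (trans (cong (side s) (lookup-setMem-other X t v i≢j)) (sym (mem-lookup X i s)))
mem-setMem-other X {i , false} {.i , false} v x≢y | yes refl = ⊥-elim (x≢y refl)
mem-setMem-other X {i , false} {.i , true}  v x≢y | yes refl = cong proj₁ (lookup∘updateAt i X)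
mem-setMem-other X {i , true}  {.i , false} v x≢y | yes refl = cong proj₂ (lookup∘updateAt i X)
mem-setMem-other X {i , true}  {.i , true}  v x≢y | yes refl = ⊥-elim (x≢y refl)

mem-symDiff : ∀ (S S′ : Sub n) e → mem e (symDiff S S′) ≡ mem e S xor mem e S′
mem-symDiff S S′ (i , false) = cong proj₁ (lookup-zipWith _ i S S′)
mem-symDiff S S′ (i , true)  = cong proj₂ (lookup-zipWith _ i S S′)

setMem-id : ∀ (X : Sub n) y v w → mem y X ≡ v → setMem y v (setMem y w X) ≡ X
setMem-id X y v w y∈X = ≡-by-mem at
  where
  at : ∀ e → mem e (setMem y v (setMem y w X)) ≡ mem e X
  at e with toSum (e ≟E y)
  ... | inj₁ refl = trans (mem-setMem _ e v) (sym y∈X)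
  ... | inj₂ e≢y  = trans (mem-setMem-other _ v e≢y) (mem-setMem-other X w e≢y)

insert-remove : ∀ (X : Sub n) y → mem y X ≡ true → insert y (remove y X) ≡ X
insert-remove X y = setMem-id X y true false

remove-insert : ∀ (X : Sub n) y → mem y X ≡ false → remove y (insert y X) ≡ X
remove-insert X y = setMem-id X y false true

insert-remove-remove : ∀ (X : Sub n) x y → mem x X ≡ true → x ≢ y → insert x (remove y (remove x X)) ≡ remove y X
insert-remove-remove X x y x∈X x≢y = ≡-by-mem at
  where
  at : ∀ e → mem e (insert x (remove y (remove x X))) ≡ mem e (remove y X)
  at e with toSum (e ≟E x) | toSum (e ≟E y)
  ... | inj₁ refl | _         = trans (mem-setMem _ e true) (sym (trans (mem-setMem-other X false x≢y) x∈X))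
  ... | inj₂ e≢x  | inj₁ refl = trans (mem-setMem-other _ true e≢x) (trans (mem-setMem _ e false) (sym (mem-setMem X e false)))
  ... | inj₂ e≢x  | inj₂ e≢y  = trans (mem-setMem-other _ true e≢x) (trans (mem-setMem-other _ false e≢y)
                                  (trans (mem-setMem-other X false e≢x) (sym (mem-setMem-other X false e≢y))))

lookup-remove-both : ∀ (X : Sub n) {i} s → lookup X i ≡ both → lookup (remove (i , s) X) i ≡ single (not s)
lookup-remove-both X {i} s eq = trans (lookup-setMem X i s false) (trans (cong (setSide s false) eq) (entry s))
  where entry : ∀ s → setSide s false both ≡ single (not s)
        entry false = refl
        entry true  = refl

lookup-remove-single : ∀ (X : Sub n) {i} s → lookup X i ≡ single s → lookup (remove (i , s) X) i ≡ neither
lookup-remove-single X {i} s eq = trans (lookup-setMem X i s false) (trans (cong (setSide s false) eq) (entry s))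
  where entry : ∀ s → setSide s false (single s) ≡ neither
        entry false = refl
        entry true  = refl

lookup-insert-single : ∀ (X : Sub n) {i} s → lookup X i ≡ single (not s) → lookup (insert (i , s) X) i ≡ both
lookup-insert-single X {i} s eq = trans (lookup-setMem X i s true) (trans (cong (setSide s true) eq) (entry s))
  where entry : ∀ s → setSide s true (single (not s)) ≡ both
        entry false = refl
        entry true  = refl

lookup-insert-neither : ∀ (X : Sub n) {i} s → lookup X i ≡ neither → lookup (insert (i , s) X) i ≡ single s
lookup-insert-neither X {i} s eq = trans (lookup-setMem X i s true) (trans (cong (setSide s true) eq) (entry s))
  where entry : ∀ s → setSide s true neither ≡ single s
        entry false = refl
        entry true  = refl

inDiff-true : ∀ (X Y : Sub n) e → inDiff X Y e ≡ true → mem e X ≡ true × mem e Y ≡ false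
inDiff-true X Y e d with mem e X | mem e Y
... | true | false = refl , refl

mem-by-lookup : ∀ (X : Sub n) {i} s {p} → lookup X i ≡ p → mem (i , s) X ≡ side s p
mem-by-lookup X {i} s eq = trans (mem-lookup X i s) (cong (side s) eq)

mem-agree : ∀ (X Y : Sub n) {k} s → lookup X k ≡ lookup Y k → mem (k , s) X ≡ mem (k , s) Y
mem-agree X Y {k} s eq = trans (mem-by-lookup X s eq) (sym (mem-lookup Y k s))

inDiff-agree : ∀ (X Y : Sub n) {k} s → lookup X k ≡ lookup Y k → inDiff X Y (k , s) ≡ false
inDiff-agree X Y {k} s eq rewrite mem-by-lookup X s eq | sym (mem-lookup Y k s) = a∧¬a (mem (k , s) Y)
  where a∧¬a : ∀ a → a ∧ not a ≡ false
        a∧¬a false = refl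
        a∧¬a true  = refl

mem-remove : ∀ (X : Sub n) y e → mem e (remove y X) ≡ ((λ x → mem x X) without y) e
mem-remove X y e with toSum (e ≟E y)
... | inj₁ refl = trans (mem-setMem X e false) (sym (without-at (λ x → mem x X) e))
... | inj₂ e≢y  = trans (mem-setMem-other X false e≢y) (sym (without-off (λ x → mem x X) e≢y))

size-remove : ∀ (X : Sub n) y → mem y X ≡ true → size X ≡ suc (size (remove y X))
size-remove {n} X y y∈X = begin
  size X                                         ≡⟨ countB-remove-point (λ x → mem x X) y ⟩
  ind (mem y X) + countB ((λ x → mem x X) without y)
    ≡⟨ cong₂ (λ b m → ind b + m) y∈X (countIn-cong (allEls n) (λ e → sym (mem-remove X y e))) ⟩
  suc (size (remove y X))                        ∎
  where open ≡-Reasoning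

size-transversal : ∀ (T : Sub n) → IsTransversal T → size T ≡ n
size-transversal []      _  = refl
size-transversal (p ∷ T) tr = begin
  size (p ∷ T)
    ≡⟨ countB-suc (λ x → mem x (p ∷ T)) ⟩
  ind (proj₁ p) + (ind (proj₂ p) + countB (λ x → mem (sucE x) (p ∷ T)))
    ≡⟨ cong (λ m → ind (proj₁ p) + (ind (proj₂ p) + m)) (countIn-cong (allEls _) mem-sucE) ⟩
  ind (proj₁ p) + (ind (proj₂ p) + size T)
    ≡⟨ cong (λ m → ind (proj₁ p) + (ind (proj₂ p) + m)) (size-transversal T (tr ∘ suc)) ⟩
  ind (proj₁ p) + (ind (proj₂ p) + _)
    ≡⟨ single-size (tr zero) ⟩
  suc _ ∎
  where
  open ≡-Reasoning
  mem-sucE : ∀ x → mem (sucE x) (p ∷ T) ≡ mem x T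
  mem-sucE (i , false) = refl
  mem-sucE (i , true)  = refl
  single-size : ∀ {q m} → IsSingle q → ind (proj₁ q) + (ind (proj₂ q) + m) ≡ suc m
  single-size (inj₁ refl) = refl
  single-size (inj₂ refl) = refl

below-remove : ∀ (X : Sub n) y e → below X e ≡ ind (mem y X ∧ lt y e) + below (remove y X) e
below-remove {n} X y e = trans (countB-remove-point p y) (cong (ind (p y) +_) (countIn-cong (allEls n) at))
  where
  p : El n → Bool
  p x = mem x X ∧ lt x e
  at : ∀ x → (p without y) x ≡ (mem x (remove y X) ∧ lt x e)
  at x with toSum (x ≟E y)
  ... | inj₁ refl = trans (without-at p x) (sym (cong (_∧ lt x e) (mem-setMem X x false)))
  ... | inj₂ x≢y  = trans (without-off p x≢y) (sym (cong (_∧ lt x e) (mem-setMem-other X false x≢y)))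

odd-below-remove : ∀ (X : Sub n) y e → mem y X ≡ true → odd (below X e) ≡ lt y e xor odd (below (remove y X) e)
odd-below-remove X y e y∈X = begin
  odd (below X e)                                   ≡⟨ cong odd (below-remove X y e) ⟩
  odd (ind (mem y X ∧ lt y e) + below (remove y X) e) ≡⟨ odd-+ (ind (mem y X ∧ lt y e)) _ ⟩
  odd (ind (mem y X ∧ lt y e)) xor odd (below (remove y X) e)
    ≡⟨ cong (λ b → odd (ind (b ∧ lt y e)) xor odd (below (remove y X) e)) y∈X ⟩
  odd (ind (lt y e)) xor odd (below (remove y X) e) ≡⟨ cong (_xor odd (below (remove y X) e)) (odd-ind (lt y e)) ⟩
  lt y e xor odd (below (remove y X) e)             ∎
  where open ≡-Reasoning

below-remove-self : ∀ (X : Sub n) y → below (remove y X) y ≡ below X y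
below-remove-self X y = sym (begin
  below X y                                       ≡⟨ below-remove X y y ⟩
  ind (mem y X ∧ lt y y) + below (remove y X) y   ≡⟨ cong (λ b → ind (mem y X ∧ b) + below (remove y X) y) (lt-irrefl y) ⟩
  ind (mem y X ∧ false) + below (remove y X) y    ≡⟨ cong (λ b → ind b + below (remove y X) y) (∧-zeroʳ (mem y X)) ⟩
  below (remove y X) y                            ∎)
  where open ≡-Reasoning

odd-below-symDiff : ∀ (S S′ : Sub n) e → odd (below (symDiff S S′) e) ≡ odd (below S e) xor odd (below S′ e)
odd-below-symDiff {n} S S′ e = trans (cong odd (countIn-cong (allEls n) distrib))
                                     (odd-countIn-xor (allEls n) (λ x → mem x S ∧ lt x e) (λ x → mem x S′ ∧ lt x e))
  where
  distrib : ∀ x → (mem x (symDiff S S′) ∧ lt x e) ≡ ((mem x S ∧ lt x e) xor (mem x S′ ∧ lt x e))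
  distrib x = trans (cong (_∧ lt x e) (mem-symDiff S S′ x)) (Bool.∧-distribʳ-xor (lt x e) (mem x S) (mem x S′))

starCount-flip : ∀ (T T′ : Sub n) k → lookup T k ≡ single false → lookup T′ k ≡ single true →
                 (∀ m → m ≢ k → lookup T m ≡ lookup T′ m) → odd (starCount T′) ≡ not (odd (starCount T))
starCount-flip {n} T T′ k Tk T′k agree = begin
  odd (starCount T′)                      ≡⟨ cong odd (countB-remove-point (starred T′) y) ⟩
  odd (ind (starred T′ y) + countB (starred T′ without y))
    ≡⟨ cong (λ b → odd (ind b + countB (starred T′ without y))) (mem-by-lookup T′ true T′k) ⟩
  not (odd (countB (starred T′ without y))) ≡⟨ cong (not ∘ odd) (countIn-cong (allEls n) same-off-y) ⟩
  not (odd (countB (starred T without y)))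
    ≡⟨ cong (λ b → not (odd (ind b + countB (starred T without y)))) (sym (mem-by-lookup T true Tk)) ⟩
  not (odd (ind (starred T y) + countB (starred T without y))) ≡⟨ cong (not ∘ odd) (sym (countB-remove-point (starred T) y)) ⟩
  not (odd (starCount T))                 ∎
  where
  open ≡-Reasoning
  y : El n
  y = (k , true)
  starred : Sub n → El n → Bool
  starred X x = proj₂ x ∧ mem x X
  same-off-y : ∀ x → (starred T′ without y) x ≡ (starred T without y) x
  same-off-y (m , false) = refl
  same-off-y (m , true) with toSum (m ≟ k)
  ... | inj₁ refl = trans (without-at (starred T′) y) (sym (without-at (starred T) y))
  ... | inj₂ m≢k  = trans (without-off (starred T′) (m≢k ∘ cong proj₁))
                         (trans (cong proj₂ (sym (agree m m≢k))) (sym (without-off (starred T) (m≢k ∘ cong proj₁))))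

-- Hyper-transversals, hypo-transversals and the sets of 𝒜_n

record HyperAt (S : Sub n) (j : Fin n) : Set where
  field
    pair-at    : lookup S j ≡ both
    single-off : ∀ k → k ≢ j → IsSingle (lookup S k)

record HypoAt (H : Sub n) (j : Fin n) : Set where
  field
    hole-at    : lookup H j ≡ neither
    single-off : ∀ k → k ≢ j → IsSingle (lookup H k)

record AAt (X : Sub n) (j l : Fin n) : Set where
  field
    pair≢hole  : j ≢ l
    pair-at    : lookup X j ≡ both
    hole-at    : lookup X l ≡ neither
    single-off : ∀ k → k ≢ j → k ≢ l → IsSingle (lookup X k)

transversal-at : ∀ {X : Sub n} j → (∀ k → k ≢ j → IsSingle (lookup X k)) → IsSingle (lookup X j) → IsTransversal X
transversal-at j off at k with toSum (k ≟ j)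
... | inj₁ refl = at
... | inj₂ k≢j  = off k k≢j

remove-pair : ∀ {S : Sub n} {j} → HyperAt S j → ∀ s → IsTransversal (remove (j , s) S)
remove-pair {S = S} {j} hS s = transversal-at {X = remove (j , s) S} j
  (λ k k≢j → subst IsSingle (sym (lookup-setMem-other S s false k≢j)) (HyperAt.single-off hS k k≢j))
  (subst IsSingle (sym (lookup-remove-both S s (HyperAt.pair-at hS))) (single-isSingle (not s)))

insert-hyper : ∀ {T : Sub n} {k} s → IsTransversal T → lookup T k ≡ single (not s) → HyperAt (insert (k , s) T) k
insert-hyper {T = T} {k} s tT Tk = record
  { pair-at    = lookup-insert-single T s Tk
  ; single-off = λ m m≢k → subst IsSingle (sym (lookup-setMem-other T s true m≢k)) (tT m)
  }

remove-hypo : ∀ {T : Sub n} {k} s → IsTransversal T → lookup T k ≡ single s → HypoAt (remove (k , s) T) k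
remove-hypo {T = T} {k} s tT Tk = record
  { hole-at    = lookup-remove-single T s Tk
  ; single-off = λ m m≢k → subst IsSingle (sym (lookup-setMem-other T s false m≢k)) (tT m)
  }

insert-hole : ∀ {H : Sub n} {k} → HypoAt H k → ∀ s → IsTransversal (insert (k , s) H)
insert-hole {H = H} {k} hH s = transversal-at {X = insert (k , s) H} k
  (λ m m≢k → subst IsSingle (sym (lookup-setMem-other H s true m≢k)) (HypoAt.single-off hH m m≢k))
  (subst IsSingle (sym (lookup-insert-neither H s (HypoAt.hole-at hH))) (single-isSingle s))

remove-single-A : ∀ {S : Sub n} {j i} s → HyperAt S j → i ≢ j → lookup S i ≡ single s → AAt (remove (i , s) S) j i
remove-single-A {S = S} {j} {i} s hS i≢j Si = record
  { pair≢hole  = i≢j ∘ sym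
  ; pair-at    = trans (lookup-setMem-other S s false (i≢j ∘ sym)) (HyperAt.pair-at hS)
  ; hole-at    = lookup-remove-single S s Si
  ; single-off = λ k k≢j k≢i → subst IsSingle (sym (lookup-setMem-other S s false k≢i)) (HyperAt.single-off hS k k≢j)
  }

HyperAt⇒IsHyper : ∀ {S : Sub n} {j} → HyperAt S j → IsHyper S
HyperAt⇒IsHyper {S = S} {j} hS =
  remove (j , true) S , (j , true) , remove-pair hS true , mem-setMem S (j , true) false ,
  sym (insert-remove S (j , true) (mem-by-lookup S true (HyperAt.pair-at hS)))

IsHyper⇒HyperAt : ∀ {S : Sub n} → IsHyper S → ∃[ j ] HyperAt S j
IsHyper⇒HyperAt (T , (j , s) , tT , j∉T , refl) =
  j , insert-hyper s tT (single-by-side-false s (tT j) (trans (sym (mem-lookup T j s)) j∉T))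

HypoAt⇒IsHypo : ∀ {H : Sub n} {j} → HypoAt H j → IsHypo H
HypoAt⇒IsHypo {H = H} {j} hH =
  insert (j , false) H , (j , false) , insert-hole hH false , mem-setMem H (j , false) true ,
  sym (remove-insert H (j , false) (mem-by-lookup H false (HypoAt.hole-at hH)))

AAt⇒IsA : ∀ {X : Sub n} {j l} → AAt X j l → IsA X
AAt⇒IsA {n} {X} {j} {l} aX = size-n , j , AAt.pair-at aX , pair-unique
  where
  R Z : Sub n
  R = remove (j , true) X
  Z = insert (l , false) R
  R-hole : HypoAt R l
  R-hole = record
    { hole-at    = trans (lookup-setMem-other X true false (AAt.pair≢hole aX ∘ sym)) (AAt.hole-at aX)
    ; single-off = off
    }
    where
    off : ∀ k → k ≢ l → IsSingle (lookup R k)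
    off k k≢l with toSum (k ≟ j)
    ... | inj₁ refl = subst IsSingle (sym (lookup-remove-both X true (AAt.pair-at aX))) (inj₁ refl)
    ... | inj₂ k≢j  = subst IsSingle (sym (lookup-setMem-other X true false k≢j)) (AAt.single-off aX k k≢j k≢l)
  size-n : size X ≡ n
  size-n = begin
    size X                 ≡⟨ size-remove X (j , true) (mem-by-lookup X true (AAt.pair-at aX)) ⟩
    suc (size R)           ≡⟨ cong (suc ∘ size) (sym (remove-insert R (l , false) (mem-by-lookup R false (HypoAt.hole-at R-hole)))) ⟩
    suc (size (remove (l , false) Z)) ≡⟨ sym (size-remove Z (l , false) (mem-setMem R (l , false) true)) ⟩
    size Z                 ≡⟨ size-transversal Z (insert-hole R-hole false) ⟩
    n                      ∎
    where open ≡-Reasoning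
  pair-unique : ∀ k → lookup X k ≡ both → k ≡ j
  pair-unique k Xk with toSum (k ≟ j) | toSum (k ≟ l)
  ... | inj₁ k≡j | _         = k≡j
  ... | inj₂ _   | inj₁ refl with () ← trans (sym Xk) (AAt.hole-at aX)
  ... | inj₂ k≢j | inj₂ k≢l  with AAt.single-off aX k k≢j k≢l
  ...   | inj₁ single with () ← trans (sym Xk) single
  ...   | inj₂ single with () ← trans (sym Xk) single

remove-two-hypo : ∀ {R : Sub n} {j} → HyperAt R j → ∀ a b → mem b R ≡ true → b ≢ (j , a) → IsHypo (remove b (remove (j , a) R))
remove-two-hypo {R = R} {j} hR a (k , t) b∈R b≢q = HypoAt⇒IsHypo (remove-hypo t tT Tk)
  where
  T : Sub _
  T = remove (j , a) R
  tT : IsTransversal T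
  tT = remove-pair hR a
  Tk : lookup T k ≡ single t
  Tk = single-by-side t (tT k) (trans (sym (mem-lookup T k t)) (trans (mem-setMem-other R false b≢q) b∈R))

-- Arithmetic in a tract

module TractArithmetic (F : Tract) where
  open Tract F

  units : AbelianGroup 0ℓ 0ℓ
  units = record
    { Carrier = U ; _≈_ = _≡_ ; _∙_ = _·_ ; ε = one ; _⁻¹ = inv
    ; isAbelianGroup = record
      { isGroup = record
        { isMonoid = record
          { isSemigroup = record { isMagma = record { isEquivalence = isEquivalence ; ∙-cong = cong₂ _·_ } ; assoc = ·-assoc }
          ; identity = ·-identityˡ , λ x → trans (·-comm x one) (·-identityˡ x)
          }
        ; inverse = ·-inverseˡ , λ x → trans (·-comm x (inv x)) (·-inverseˡ x)
        ; ⁻¹-cong = cong inv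
        }
      ; comm = ·-comm
      }
    }

  open AbelianGroup units using (identityʳ; inverseʳ)
  open GroupProperties (AbelianGroup.group units) using (identityʳ-unique; inverseˡ-unique; ⁻¹-injective)
  open CommutativeSemigroupProperties (AbelianGroup.commutativeSemigroup units) using (x∙yz≈y∙xz; xy∙z≈xz∙y)

  null-pair⇒≡ : ∀ a b → N (a ∷ neg · b ∷ []) → a ≡ b
  null-pair⇒≡ a b null = ⁻¹-injective (inverseˡ-unique (inv a) b (identityʳ-unique neg (inv a · b) neg·a⁻¹b≡neg))
    where
    a⁻¹·neg·b≡neg : inv a · (neg · b) ≡ neg
    a⁻¹·neg·b≡neg = neg-unique _ (subst (λ u → N (u ∷ inv a · (neg · b) ∷ [])) (·-inverseˡ a) (N-scale (inv a) _ null))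
    neg·a⁻¹b≡neg : neg · (inv a · b) ≡ neg
    neg·a⁻¹b≡neg = trans (x∙yz≈y∙xz neg (inv a) b) a⁻¹·neg·b≡neg

  neg·neg : neg · neg ≡ one
  neg·neg = null-pair⇒≡ (neg · neg) one (N-perm (swap _ _ ↭-refl) (N-scale neg _ neg-null))

  sign : Bool → Elt F → Elt F
  sign false x = x
  sign true  x = scaleF F neg x

  sign-nothing : ∀ b → sign b nothing ≡ nothing
  sign-nothing false = refl
  sign-nothing true  = refl

  neg-neg : ∀ (x : Elt F) → scaleF F neg (scaleF F neg x) ≡ x
  neg-neg nothing  = refl
  neg-neg (just u) = cong just (trans (sym (·-assoc neg neg u)) (trans (cong (_· u) neg·neg) (·-identityˡ u)))

  sign-sign : ∀ a b x → sign a (sign b x) ≡ sign (a xor b) x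
  sign-sign false b     x = refl
  sign-sign true  false x = refl
  sign-sign true  true  x = neg-neg x

  sign-involutive : ∀ b x → sign b (sign b x) ≡ x
  sign-involutive false x = refl
  sign-involutive true  x = neg-neg x

  sgn-sign : ∀ k x → sgn F k x ≡ sign (odd k) x
  sgn-sign zero    x = refl
  sgn-sign (suc k) x = trans (cong (scaleF F neg) (sgn-sign k x)) (sign-sign true (odd k) x)

  mulF-signˡ : ∀ b x y → mulF F (sign b x) y ≡ sign b (mulF F x y)
  mulF-signˡ false x        y        = refl
  mulF-signˡ true  nothing  y        = refl
  mulF-signˡ true  (just u) nothing  = refl
  mulF-signˡ true  (just u) (just v) = cong just (·-assoc neg u v)

  mulF-signʳ : ∀ b x y → mulF F x (sign b y) ≡ sign b (mulF F x y)
  mulF-signʳ false x        y        = refl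
  mulF-signʳ true  nothing  y        = refl
  mulF-signʳ true  (just u) nothing  = refl
  mulF-signʳ true  (just u) (just v) = cong just (x∙yz≈y∙xz u neg v)

  nothing-or-≢ : ∀ (x : Elt F) → x ≡ nothing ⊎ x ≢ nothing
  nothing-or-≢ nothing  = inj₁ refl
  nothing-or-≢ (just _) = inj₂ λ ()

  ≡nothing-if-not-≢ : ∀ {x : Elt F} → ¬ (x ≢ nothing) → x ≡ nothing
  ≡nothing-if-not-≢ {nothing} _     = refl
  ≡nothing-if-not-≢ {just _}  ¬x≢0 = ⊥-elim (¬x≢0 (λ ()))

  mulF-nothingʳ : ∀ x → mulF F x nothing ≡ nothing
  mulF-nothingʳ nothing  = refl
  mulF-nothingʳ (just _) = refl

  mulF-≢-nothing : ∀ {x y} → x ≢ nothing → y ≢ nothing → mulF F x y ≢ nothing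
  mulF-≢-nothing {nothing} x≢0 _   = ⊥-elim (x≢0 refl)
  mulF-≢-nothing {just _} {nothing} _ y≢0 = ⊥-elim (y≢0 refl)
  mulF-≢-nothing {just _} {just _}  _ _ ()

  null-signed-pair⇒≡ : ∀ b x y → N (formal F (sign b x ∷ sign (not b) y ∷ [])) → x ≡ y
  null-signed-pair⇒≡ _     nothing  nothing  _    = refl
  null-signed-pair⇒≡ false (just u) nothing  null = ⊥-elim (N-unit u null)
  null-signed-pair⇒≡ true  (just u) nothing  null = ⊥-elim (N-unit (neg · u) null)
  null-signed-pair⇒≡ false nothing  (just v) null = ⊥-elim (N-unit (neg · v) null)
  null-signed-pair⇒≡ true  nothing  (just v) null = ⊥-elim (N-unit v null)
  null-signed-pair⇒≡ false (just u) (just v) null = cong just (null-pair⇒≡ u v null)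
  null-signed-pair⇒≡ true  (just u) (just v) null = cong just (sym (null-pair⇒≡ v u (N-perm (swap _ _ ↭-refl) null)))

  SameSupport : {A : Set} → (A → Elt F) → (A → Elt F) → Set
  SameSupport f g = ∀ e → (f e ≡ nothing → g e ≡ nothing) × (g e ≡ nothing → f e ≡ nothing)

  _∝_ : {A : Set} → (A → Elt F) → (A → Elt F) → Set
  f ∝ g = ∃[ α ] (∀ e → f e ≡ scaleF F α (g e))

  ∝-refl : {A : Set} (f : A → Elt F) → f ∝ f
  ∝-refl f = one , λ e → one-scales (f e)
    where
    one-scales : ∀ x → x ≡ scaleF F one x
    one-scales nothing  = refl
    one-scales (just u) = cong just (sym (·-identityˡ u))

  ∝-trans : {A : Set} {f g h : A → Elt F} → f ∝ g → g ∝ h → f ∝ h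
  ∝-trans {h = h} (α , f≡αg) (β , g≡βh) = α · β , λ e → trans (f≡αg e) (trans (cong (scaleF F α) (g≡βh e)) (scale-· (h e)))
    where
    scale-· : ∀ x → scaleF F α (scaleF F β x) ≡ scaleF F (α · β) x
    scale-· nothing  = refl
    scale-· (just u) = cong just (sym (·-assoc α β u))

  ∝-sameSupport : {A : Set} {f g h : A → Elt F} → f ∝ g → SameSupport f h → SameSupport g h
  ∝-sameSupport {f = f} {g} (α , f≡αg) same e =
    (λ g≡0 → proj₁ (same e) (trans (f≡αg e) (cong (scaleF F α) g≡0))) ,
    (λ h≡0 → unscale (g e) (trans (sym (f≡αg e)) (proj₂ (same e) h≡0)))
    where
    unscale : ∀ x → scaleF F α x ≡ nothing → x ≡ nothing
    unscale nothing _ = refl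

  ∝-by-cross : {A : Set} (f g : A → Elt F) (q : A) → f q ≢ nothing → g q ≢ nothing →
               (∀ e → mulF F (f q) (g e) ≡ mulF F (f e) (g q)) → f ∝ g
  ∝-by-cross f g q fq≢0 gq≢0 cross with f q | g q
  ... | nothing | _       = ⊥-elim (fq≢0 refl)
  ... | just _  | nothing = ⊥-elim (gq≢0 refl)
  ... | just u  | just v  = u · inv v , λ e → ratio (f e) (g e) (cross e)
    where
    ratio : ∀ x y → mulF F (just u) y ≡ mulF F x (just v) → x ≡ scaleF F (u · inv v) y
    ratio nothing  nothing  _  = refl
    ratio (just s) (just r) eq = cong just (begin
      s                     ≡⟨ sym (identityʳ s) ⟩
      s · one               ≡⟨ cong (s ·_) (sym (inverseʳ v)) ⟩
      s · (v · inv v)       ≡⟨ sym (·-assoc s v (inv v)) ⟩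
      (s · v) · inv v       ≡⟨ cong (_· inv v) (sym (just-injective eq)) ⟩
      (u · r) · inv v       ≡⟨ xy∙z≈xz∙y u r (inv v) ⟩
      (u · inv v) · r       ∎)
      where open ≡-Reasoning

-- Formal sums

module _ {A : Set} where

  catMaybes-∷ : ∀ a (ts : List (Maybe A)) → catMaybes (a ∷ ts) ≡ catMaybes (a ∷ []) ++ catMaybes ts
  catMaybes-∷ (just _) ts = refl
  catMaybes-∷ nothing  ts = refl

  formal-none : ∀ (xs : List (El n)) {t : El n → Maybe A} → (∀ e → t e ≡ nothing) → catMaybes (map t xs) ≡ []
  formal-none []       h = refl
  formal-none (x ∷ xs) h rewrite h x = formal-none xs h

  formal-suc : ∀ (t : El (suc n) → Maybe A) →
               catMaybes (map t (allEls (suc n))) ≡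
               catMaybes (t (zero , false) ∷ []) ++ (catMaybes (t (zero , true) ∷ []) ++ catMaybes (map (t ∘ sucE) (allEls n)))
  formal-suc {n} t = trans (cong (catMaybes ∘ map t) allEls-suc)
                           (trans (cong (λ ts → catMaybes (t (zero , false) ∷ t (zero , true) ∷ ts)) (sym (map-∘ (allEls n))))
                                  (trans (catMaybes-∷ (t (zero , false)) (t (zero , true) ∷ map (t ∘ sucE) (allEls n)))
                                         (cong (catMaybes (t (zero , false) ∷ []) ++_) (catMaybes-∷ (t (zero , true)) (map (t ∘ sucE) (allEls n))))))

  formal-point : ∀ {t : El n → Maybe A} y → (∀ e → e ≢ y → t e ≡ nothing) → catMaybes (map t (allEls n)) ≡ catMaybes (t y ∷ [])
  formal-point {suc n} {t} (zero , false) h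
    rewrite formal-suc t | h (zero , true) (λ ()) | formal-none (allEls n) {t ∘ sucE} (λ e → h (sucE e) (λ ())) = ++-identityʳ _
  formal-point {suc n} {t} (zero , true) h
    rewrite formal-suc t | h (zero , false) (λ ()) | formal-none (allEls n) {t ∘ sucE} (λ e → h (sucE e) (λ ())) = ++-identityʳ _
  formal-point {suc n} {t} (suc i , s) h
    rewrite formal-suc t | h (zero , false) (λ ()) | h (zero , true) (λ ()) =
    formal-point {t = t ∘ sucE} (i , s) (λ e e≢y → h (sucE e) (e≢y ∘ sucE-injective))

  formal-merge : ∀ (xs : List (El n)) {t t₁ t₂ : El n → Maybe A} →
                 (∀ e → (t₁ e ≡ t e × t₂ e ≡ nothing) ⊎ (t₁ e ≡ nothing × t₂ e ≡ t e)) →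
                 catMaybes (map t xs) ↭ catMaybes (map t₁ xs) ++ catMaybes (map t₂ xs)
  formal-merge []       h = ↭-refl
  formal-merge (x ∷ xs) {t} {t₁} {t₂} h with h x
  ... | inj₁ (eq₁ , eq₂) rewrite eq₁ | eq₂ with t x
  ...   | just u  = prep u (formal-merge xs h)
  ...   | nothing = formal-merge xs h
  formal-merge (x ∷ xs) {t} {t₁} {t₂} h | inj₂ (eq₁ , eq₂) rewrite eq₁ | eq₂ with t x
  ...   | just u  = ↭-trans (prep u (formal-merge xs h)) (↭-sym (shift u (catMaybes (map t₁ xs)) _))
  ...   | nothing = formal-merge xs h

  formal-two-points : ∀ {t : El n → Maybe A} q b → q ≢ b → (∀ e → e ≢ q → e ≢ b → t e ≡ nothing) →
                      catMaybes (map t (allEls n)) ↭ catMaybes (t q ∷ t b ∷ [])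
  formal-two-points {n} {t} q b q≢b off = begin
    catMaybes (map t (allEls n))                                    ↭⟨ formal-merge (allEls n) split ⟩
    catMaybes (map at-q (allEls n)) ++ catMaybes (map off-q (allEls n)) ≡⟨ cong₂ _++_ (formal-point q at-q-off) (formal-point b off-q-off) ⟩
    catMaybes (at-q q ∷ []) ++ catMaybes (off-q b ∷ [])             ≡⟨ cong₂ (λ x y → catMaybes (x ∷ []) ++ catMaybes (y ∷ [])) at-q-q off-q-b ⟩
    catMaybes (t q ∷ []) ++ catMaybes (t b ∷ [])                    ≡⟨ sym (catMaybes-∷ (t q) (t b ∷ [])) ⟩
    catMaybes (t q ∷ t b ∷ [])                                      ∎
    where
    open PermutationReasoning
    at-q off-q : El n → Maybe A
    at-q e with toSum (e ≟E q)
    ... | inj₁ _ = t e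
    ... | inj₂ _ = nothing
    off-q e with toSum (e ≟E q)
    ... | inj₁ _ = nothing
    ... | inj₂ _ = t e
    split : ∀ e → (at-q e ≡ t e × off-q e ≡ nothing) ⊎ (at-q e ≡ nothing × off-q e ≡ t e)
    split e with toSum (e ≟E q)
    ... | inj₁ _ = inj₁ (refl , refl)
    ... | inj₂ _ = inj₂ (refl , refl)
    at-q-off : ∀ e → e ≢ q → at-q e ≡ nothing
    at-q-off e e≢q with toSum (e ≟E q)
    ... | inj₁ e≡q = ⊥-elim (e≢q e≡q)
    ... | inj₂ _   = refl
    off-q-off : ∀ e → e ≢ b → off-q e ≡ nothing
    off-q-off e e≢b with toSum (e ≟E q)
    ... | inj₁ _   = refl
    ... | inj₂ e≢q = off e e≢q e≢b
    at-q-q : at-q q ≡ t q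
    at-q-q with toSum (q ≟E q)
    ... | inj₁ _   = refl
    ... | inj₂ q≢q = ⊥-elim (q≢q refl)
    off-q-b : off-q b ≡ t b
    off-q-b with toSum (b ≟E q)
    ... | inj₁ b≡q = ⊥-elim (q≢b (sym b≡q))
    ... | inj₂ _   = refl

-- The Grassmann–Plücker argument

module GrassmannPlücker (F : Tract) (n : ℕ) (φ : Sub n → Elt F) (gp : IsWeakRestrictedGP F n φ) where
  open Tract F using (N; N-perm)
  open TractArithmetic F
  open IsWeakRestrictedGP gp
  open IsAntisymmetricMatroid (proj₁ support-even)

  Supported : Sub n → Set
  Supported = Support F φ

  X : Sub n → El n → Elt F
  X = Xvec F φ

  X-outside : ∀ S e → mem e S ≡ false → X S e ≡ nothing
  X-outside S e e∉S = cong (λ b → if b then sgn F (below S e) (φ (remove e S)) else nothing) e∉S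

  X-inside : ∀ S e → mem e S ≡ true → X S e ≡ sign (odd (below S e)) (φ (remove e S))
  X-inside S e e∈S = trans (cong (λ b → if b then sgn F (below S e) (φ (remove e S)) else nothing) e∈S)
                             (sgn-sign (below S e) (φ (remove e S)))

  φ-by-X : ∀ S e → mem e S ≡ true → φ (remove e S) ≡ sign (odd (below S e)) (X S e)
  φ-by-X S e e∈S = sym (trans (cong (sign (odd (below S e))) (X-inside S e e∈S)) (sign-involutive (odd (below S e)) _))

  X≢0⇒mem : ∀ S e → X S e ≢ nothing → mem e S ≡ true
  X≢0⇒mem S e X≢0 with mem e S
  ... | true  = refl
  ... | false = ⊥-elim (X≢0 refl)

  X≢0⇒φ≢0 : ∀ S e → X S e ≢ nothing → φ (remove e S) ≢ nothing
  X≢0⇒φ≢0 S e X≢0 φ≡0 =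
    X≢0 (trans (X-inside S e (X≢0⇒mem S e X≢0)) (trans (cong (sign (odd (below S e))) φ≡0) (sign-nothing (odd (below S e)))))

  φ≢0⇒X≢0 : ∀ S e → mem e S ≡ true → φ (remove e S) ≢ nothing → X S e ≢ nothing
  φ≢0⇒X≢0 S e e∈S φ≢0 X≡0 =
    φ≢0 (trans (φ-by-X S e e∈S) (trans (cong (sign (odd (below S e))) X≡0) (sign-nothing (odd (below S e)))))

  supported-transversal : ∀ {T} → IsTransversal T → φ T ≢ nothing → Supported T
  supported-transversal tT φ≢0 = inj₁ tT , φ≢0

  supported-A : ∀ {A j l} → AAt A j l → φ A ≢ nothing → Supported A
  supported-A aA φ≢0 = inj₂ (AAt⇒IsA aA) , φ≢0

  supported-parity : ∀ T → Supported T → IsTransversal T → odd (starCount T) ≡ proj₁ (proj₂ support-even)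
  supported-parity = proj₂ (proj₂ support-even)

  no-supported-flip : ∀ {T T′ k} → Supported T → Supported T′ → IsTransversal T → IsTransversal T′ →
                      lookup T k ≡ single false → lookup T′ k ≡ single true → ¬ (∀ m → m ≢ k → lookup T m ≡ lookup T′ m)
  no-supported-flip {T} {T′} {k} sT sT′ tT tT′ Tk T′k agree =
    not-¬ refl (trans (sym (supported-parity T′ sT′ tT′))
                      (trans (starCount-flip T T′ k Tk T′k agree) (cong not (supported-parity T sT tT))))

  supported-transversals-agree : ∀ {T T′} k → Supported T → Supported T′ → IsTransversal T → IsTransversal T′ →
                                 (∀ m → m ≢ k → lookup T m ≡ lookup T′ m) → lookup T k ≡ lookup T′ k
  supported-transversals-agree k sT sT′ tT tT′ agree with tT k | tT′ k
  ... | inj₁ Tk | inj₁ T′k = trans Tk (sym T′k)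
  ... | inj₂ Tk | inj₂ T′k = trans Tk (sym T′k)
  ... | inj₁ Tk | inj₂ T′k = ⊥-elim (no-supported-flip sT sT′ tT tT′ Tk T′k agree)
  ... | inj₂ Tk | inj₁ T′k = ⊥-elim (no-supported-flip sT′ sT tT′ tT T′k Tk (λ m m≢k → sym (agree m m≢k)))

  pair-side-unique : ∀ {S j} → HyperAt S j → ∀ {a b} → X S (j , a) ≢ nothing → X S (j , b) ≢ nothing → a ≡ b
  pair-side-unique {S} {j} hS {a} {b} Xa≢0 Xb≢0 =
    not-injective (single-injective (begin
      single (not a)                ≡⟨ sym (lookup-remove-both S a (HyperAt.pair-at hS)) ⟩
      lookup (remove (j , a) S) j   ≡⟨ supported-transversals-agree j (supported (remove-pair hS a) Xa≢0)
                                         (supported (remove-pair hS b) Xb≢0) (remove-pair hS a) (remove-pair hS b) off-j ⟩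
      lookup (remove (j , b) S) j   ≡⟨ lookup-remove-both S b (HyperAt.pair-at hS) ⟩
      single (not b)                ∎))
    where
    open ≡-Reasoning
    supported : ∀ {c} → IsTransversal (remove (j , c) S) → X S (j , c) ≢ nothing → Supported (remove (j , c) S)
    supported {c} t X≢0 = supported-transversal t (X≢0⇒φ≢0 S (j , c) X≢0)
    off-j : ∀ m → m ≢ j → lookup (remove (j , a) S) m ≡ lookup (remove (j , b) S) m
    off-j m m≢j = trans (lookup-setMem-other S a false m≢j) (sym (lookup-setMem-other S b false m≢j))

  swapIn-supported : ∀ {A j l} → AAt A j l → Supported A → Supported (swapIn A l j)
  swapIn-supported {A} {j} {l} aA sA =
    subst Supported swapIn-T (proj₁ (symmetry T tT l j (AAt.pair≢hole aA ∘ sym)) (subst Supported (sym swapOut-T) sA))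
    where
    -- Any transversal agreeing with A off {j, l} will do.
    T : Sub n
    T = (A [ j ]≔ single false) [ l ]≔ single false
    T-off : ∀ m → m ≢ j → m ≢ l → lookup T m ≡ lookup A m
    T-off m m≢j m≢l = trans (lookup-≔-other (A [ j ]≔ single false) (single false) m≢l) (lookup-≔-other A (single false) m≢j)
    tT : IsTransversal T
    tT m with toSum (m ≟ l) | toSum (m ≟ j)
    ... | inj₁ refl | _         = subst IsSingle (sym (lookup-≔ (A [ j ]≔ single false) m (single false))) (inj₁ refl)
    ... | inj₂ m≢l  | inj₁ refl = subst IsSingle (sym (trans (lookup-≔-other (A [ j ]≔ single false) (single false) m≢l)
                                                               (lookup-≔ A m (single false)))) (inj₁ refl)
    ... | inj₂ m≢l  | inj₂ m≢j  = subst IsSingle (sym (T-off m m≢j m≢l)) (AAt.single-off aA m m≢j m≢l)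
    swapOut-T : swapOut T l j ≡ A
    swapOut-T = ≡-by-lookup at
      where
      at : ∀ m → lookup (swapOut T l j) m ≡ lookup A m
      at m with toSum (m ≟ j) | toSum (m ≟ l)
      ... | inj₁ refl | _         = trans (lookup-≔ (T [ l ]≔ neither) m both) (sym (AAt.pair-at aA))
      ... | inj₂ m≢j  | inj₁ refl = trans (lookup-≔-other (T [ l ]≔ neither) both m≢j) (trans (lookup-≔ T m neither) (sym (AAt.hole-at aA)))
      ... | inj₂ m≢j  | inj₂ m≢l  = trans (lookup-≔-other (T [ l ]≔ neither) both m≢j) (trans (lookup-≔-other T neither m≢l) (T-off m m≢j m≢l))
    swapIn-T : swapIn T l j ≡ swapIn A l j
    swapIn-T = ≡-by-lookup at
      where
      at : ∀ m → lookup (swapIn T l j) m ≡ lookup (swapIn A l j) m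
      at m with toSum (m ≟ j) | toSum (m ≟ l)
      ... | inj₁ refl | _         = trans (lookup-≔ (T [ l ]≔ both) m neither) (sym (lookup-≔ (A [ l ]≔ both) m neither))
      ... | inj₂ m≢j  | inj₁ refl = trans (lookup-≔-other (T [ l ]≔ both) neither m≢j) (trans (lookup-≔ T m both)
                                      (sym (trans (lookup-≔-other (A [ l ]≔ both) neither m≢j) (lookup-≔ A m both))))
      ... | inj₂ m≢j  | inj₂ m≢l  = trans (lookup-≔-other (T [ l ]≔ both) neither m≢j) (trans (lookup-≔-other T both m≢l) (trans (T-off m m≢j m≢l)
                                      (sym (trans (lookup-≔-other (A [ l ]≔ both) neither m≢j) (lookup-≔-other A both m≢l)))))

  -- Exchange at e between H = Q ∪ {e} and H′ = A ∖ {e}, where Q is A with pair and hole swapped by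
  -- symmetry: the partner of e is (i , s) or (i , not s), putting S ∖ {j} or S ∖ {j*} in the support.
  module PairInSupport {S j} (hS : HyperAt S j) {i} (i≢j : i ≢ j) {s} (Si : lookup S i ≡ single s)
                       (Xx≢0 : X S (i , s) ≢ nothing) where
    x e : El n
    x = (i , s)
    e = (j , false)

    x∈S : mem x S ≡ true
    x∈S = trans (mem-by-lookup S s Si) (side-single s)

    A Q H H′ : Sub n
    A  = remove x S
    Q  = swapIn A i j
    H  = insert e Q
    H′ = remove e A

    aA : AAt A j i
    aA = remove-single-A s hS i≢j Si

    sA : Supported A
    sA = supported-A aA (X≢0⇒φ≢0 S x Xx≢0)

    A-off : ∀ m → m ≢ i → lookup A m ≡ lookup S m
    A-off m m≢i = lookup-setMem-other S s false m≢i

    Q-at-j : lookup Q j ≡ neither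
    Q-at-j = lookup-≔ (A [ i ]≔ both) j neither

    H-at-i : lookup H i ≡ both
    H-at-i = trans (lookup-setMem-other Q false true i≢j) (trans (lookup-≔-other (A [ i ]≔ both) neither i≢j) (lookup-≔ A i both))

    H-at-j : lookup H j ≡ single false
    H-at-j = lookup-insert-neither Q false Q-at-j

    H-off : ∀ m → m ≢ i → m ≢ j → lookup H m ≡ lookup S m
    H-off m m≢i m≢j = trans (lookup-setMem-other Q false true m≢j)
                        (trans (lookup-≔-other (A [ i ]≔ both) neither m≢j) (trans (lookup-≔-other A both m≢i) (A-off m m≢i)))

    H′-at-j : lookup H′ j ≡ single true
    H′-at-j = lookup-remove-both A false (AAt.pair-at aA)

    H′-off : ∀ m → m ≢ i → m ≢ j → lookup H′ m ≡ lookup S m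
    H′-off m m≢i m≢j = trans (lookup-setMem-other A false false m≢j) (A-off m m≢i)

    hyper-H : HyperAt H i
    hyper-H = record { pair-at = H-at-i ; single-off = off }
      where
      off : ∀ m → m ≢ i → IsSingle (lookup H m)
      off m m≢i with toSum (m ≟ j)
      ... | inj₁ refl = subst IsSingle (sym H-at-j) (inj₁ refl)
      ... | inj₂ m≢j  = subst IsSingle (sym (H-off m m≢i m≢j)) (HyperAt.single-off hS m m≢j)

    hypo-H′ : HypoAt H′ i
    hypo-H′ = record { hole-at = trans (lookup-setMem-other A false false i≢j) (AAt.hole-at aA) ; single-off = off }
      where
      off : ∀ m → m ≢ i → IsSingle (lookup H′ m)
      off m m≢i with toSum (m ≟ j)
      ... | inj₁ refl = subst IsSingle (sym H′-at-j) (inj₂ refl)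
      ... | inj₂ m≢j  = subst IsSingle (sym (H′-off m m≢i m≢j)) (HyperAt.single-off hS m m≢j)

    e∈H∖H′ : inDiff H H′ e ≡ true
    e∈H∖H′ = cong₂ (λ a b → a ∧ not b) (mem-setMem Q e true) (mem-setMem A e false)

    remove-e-H : remove e H ≡ Q
    remove-e-H = remove-insert Q e (mem-by-lookup Q false Q-at-j)

    insert-e-H′ : insert e H′ ≡ A
    insert-e-H′ = insert-remove A e (mem-by-lookup A false (AAt.pair-at aA))

    remove-other-side : ∀ {t} → t ≢ s → remove (i , t) H ≡ remove (j , true) S
    remove-other-side {t} t≢s = ≡-by-lookup at
      where
      at : ∀ m → lookup (remove (i , t) H) m ≡ lookup (remove (j , true) S) m
      at m with toSum (m ≟ i) | toSum (m ≟ j)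
      ... | inj₁ refl | _         = trans (lookup-remove-both H t H-at-i)
                                      (trans (cong single (sym (¬-not (t≢s ∘ sym)))) (sym (trans (lookup-setMem-other S true false i≢j) Si)))
      ... | inj₂ m≢i  | inj₁ refl = trans (lookup-setMem-other H t false m≢i) (trans H-at-j (sym (lookup-remove-both S true (HyperAt.pair-at hS))))
      ... | inj₂ m≢i  | inj₂ m≢j  = trans (lookup-setMem-other H t false m≢i) (trans (H-off m m≢i m≢j) (sym (lookup-setMem-other S true false m≢j)))

    pair-side : ∀ f → f ≢ e → inDiff H H′ f ≡ true → Supported (remove f H) → Supported (insert f H′) →
                ∃[ a ] X S (j , a) ≢ nothing
    pair-side (k , t) f≢e f∈H∖H′ sR sI with toSum (k ≟ i)
    pair-side (k , t) f≢e f∈H∖H′ sR sI | inj₂ k≢i with toSum (k ≟ j)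
    ... | inj₂ k≢j  with () ← trans (sym f∈H∖H′) (inDiff-agree H H′ t (trans (H-off k k≢i k≢j) (sym (H′-off k k≢i k≢j))))
    ... | inj₁ refl with t
    ...   | false = ⊥-elim (f≢e refl)
    ...   | true with () ← trans (sym f∈H∖H′) (cong (λ b → b ∧ not (mem (k , true) H′)) (mem-by-lookup H true H-at-j))
    pair-side (k , t) f≢e f∈H∖H′ sR sI | inj₁ refl with t Bool.≟ s
    ... | yes refl = false , φ≢0⇒X≢0 S e (mem-by-lookup S false (HyperAt.pair-at hS))
                               (subst (λ Y → φ Y ≢ nothing) (insert-remove-remove S x e x∈S (i≢j ∘ cong proj₁)) (proj₂ sI))
    ... | no t≢s   = true , φ≢0⇒X≢0 S (j , true) (mem-by-lookup S true (HyperAt.pair-at hS))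
                               (subst (λ Y → φ Y ≢ nothing) (remove-other-side t≢s) (proj₂ sR))

    result : ∃[ a ] X S (j , a) ≢ nothing
    result with exchange H H′ (HyperAt⇒IsHyper hyper-H) (HypoAt⇒IsHypo hypo-H′) e e∈H∖H′
                  (subst Supported (sym remove-e-H) (swapIn-supported aA sA)) (subst Supported (sym insert-e-H′) sA)
    ... | f , f≢e , f∈H∖H′ , sR , sI = pair-side f f≢e f∈H∖H′ sR sI

  pair-in-support : ∀ {S j} → HyperAt S j → ∀ e → X S e ≢ nothing → ∃[ a ] X S (j , a) ≢ nothing
  pair-in-support {S} {j} hS (i , s) X≢0 with toSum (i ≟ j)
  ... | inj₁ refl = s , X≢0
  ... | inj₂ i≢j  =
    PairInSupport.result hS i≢j
      (single-by-side s (HyperAt.single-off hS i i≢j) (trans (sym (mem-lookup S i s)) (X≢0⇒mem S (i , s) X≢0))) X≢0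

  gpTerm : Sub n → Sub n → El n → Elt F
  gpTerm S S′ e = if inDiff S S′ e then sgn F (below (symDiff S S′) e) (mulF F (φ (remove e S)) (φ (insert e S′))) else nothing

  gpTerm-by-X : ∀ S S′ e → mem e S′ ≡ false → gpTerm S S′ e ≡ sign (odd (below S′ e)) (mulF F (X S e) (φ (insert e S′)))
  gpTerm-by-X S S′ e e∉S′ with mem e S
  ... | false = sym (sign-nothing (odd (below S′ e)))
  ... | true rewrite e∉S′ = begin
    sgn F (below (symDiff S S′) e) (mulF F φS φ′)  ≡⟨ sgn-sign (below (symDiff S S′) e) _ ⟩
    sign (odd (below (symDiff S S′) e)) (mulF F φS φ′) ≡⟨ cong (λ b → sign b (mulF F φS φ′)) (odd-below-symDiff S S′ e) ⟩
    sign (bS xor bS′) (mulF F φS φ′)                ≡⟨ cong (λ b → sign b (mulF F φS φ′)) (Bool.xor-comm bS bS′) ⟩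
    sign (bS′ xor bS) (mulF F φS φ′)                ≡⟨ sym (sign-sign bS′ bS _) ⟩
    sign bS′ (sign bS (mulF F φS φ′))               ≡⟨ cong (sign bS′) (sym (mulF-signˡ bS φS φ′)) ⟩
    sign bS′ (mulF F (sign bS φS) φ′)               ≡⟨ cong (λ y → sign bS′ (mulF F y φ′)) (sym (sgn-sign (below S e) φS)) ⟩
    sign bS′ (mulF F (sgn F (below S e) φS) φ′)     ∎
    where
    open ≡-Reasoning
    φS φ′ : Elt F
    φS = φ (remove e S)
    φ′ = φ (insert e S′)
    bS bS′ : Bool
    bS  = odd (below S e)
    bS′ = odd (below S′ e)

  -- (rGP2′) for S and R ∖ {q, b}: the summands off q and b vanish, and the two left have opposite signs.
  module TwoTermRelation {S R j} a b (hyper-S : IsHyper S) (hR : HyperAt R j) (b∈R : mem b R ≡ true) (b≢q : b ≢ (j , a))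
                         (small : countB (inDiff S (remove b (remove (j , a) R))) ≤ 4)
                         (vanish : ∀ e → mem e S ≡ true → mem e R ≡ false → X S e ≡ nothing) where
    q : El n
    q = (j , a)

    S′ : Sub n
    S′ = remove b (remove q R)

    q∈R : mem q R ≡ true
    q∈R = trans (mem-by-lookup R a (HyperAt.pair-at hR)) (side-both a)

    b∈R∖q : mem b (remove q R) ≡ true
    b∈R∖q = trans (mem-setMem-other R false b≢q) b∈R

    q∉S′ : mem q S′ ≡ false
    q∉S′ = trans (mem-setMem-other (remove q R) false (b≢q ∘ sym)) (mem-setMem R q false)

    term : ∀ e f → mem e S′ ≡ false → insert e S′ ≡ remove f R → mem f R ≡ true →
           gpTerm S S′ e ≡ sign (odd (below S′ e) xor odd (below R f)) (mulF F (X S e) (X R f))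
    term e f e∉S′ eq f∈R = begin
      gpTerm S S′ e                                              ≡⟨ gpTerm-by-X S S′ e e∉S′ ⟩
      sign (odd (below S′ e)) (mulF F (X S e) (φ (insert e S′))) ≡⟨ cong (λ Y → sign (odd (below S′ e)) (mulF F (X S e) (φ Y))) eq ⟩
      sign (odd (below S′ e)) (mulF F (X S e) (φ (remove f R)))  ≡⟨ cong (λ y → sign (odd (below S′ e)) (mulF F (X S e) y)) (φ-by-X R f f∈R) ⟩
      sign (odd (below S′ e)) (mulF F (X S e) (sign (odd (below R f)) (X R f)))
        ≡⟨ cong (sign (odd (below S′ e))) (mulF-signʳ (odd (below R f)) (X S e) (X R f)) ⟩
      sign (odd (below S′ e)) (sign (odd (below R f)) (mulF F (X S e) (X R f))) ≡⟨ sign-sign (odd (below S′ e)) (odd (below R f)) _ ⟩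
      sign (odd (below S′ e) xor odd (below R f)) (mulF F (X S e) (X R f)) ∎
      where open ≡-Reasoning

    signs-opposite : odd (below S′ b) xor odd (below R q) ≡ not (odd (below S′ q) xor odd (below R b))
    signs-opposite = begin
      odd (below S′ b) xor odd (below R q)                         ≡⟨ cong (odd (below S′ b) xor_) below-R-q ⟩
      odd (below S′ b) xor (not (lt q b) xor odd (below S′ q))     ≡⟨ cong (odd (below S′ b) xor_) (sym (Bool.not-distribˡ-xor (lt q b) _)) ⟩
      odd (below S′ b) xor not (lt q b xor odd (below S′ q))       ≡⟨ sym (Bool.not-distribʳ-xor (odd (below S′ b)) _) ⟩
      not (odd (below S′ b) xor (lt q b xor odd (below S′ q)))     ≡⟨ cong not (xor-rotate (odd (below S′ b)) (lt q b) _) ⟩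
      not (odd (below S′ q) xor (lt q b xor odd (below S′ b)))     ≡⟨ cong (λ c → not (odd (below S′ q) xor c)) (sym below-R-b) ⟩
      not (odd (below S′ q) xor odd (below R b))                   ∎
      where
      open ≡-Reasoning
      below-R-q : odd (below R q) ≡ not (lt q b) xor odd (below S′ q)
      below-R-q = trans (cong odd (sym (below-remove-self R q)))
                        (trans (odd-below-remove (remove q R) b q b∈R∖q) (cong (_xor odd (below S′ q)) (lt-flip (b≢q ∘ sym))))
      below-R-b : odd (below R b) ≡ lt q b xor odd (below S′ b)
      below-R-b = trans (odd-below-remove R q b q∈R) (cong (λ m → lt q b xor odd m) (sym (below-remove-self (remove q R) b)))

    off-q-b : ∀ e → e ≢ q → e ≢ b → gpTerm S S′ e ≡ nothing
    off-q-b e e≢q e≢b with inDiff S S′ e in e∈S∖S′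
    ... | false = refl
    ... | true  = trans (cong (λ y → sgn F (below (symDiff S S′) e) (mulF F y (φ (insert e S′)))) φ≡0)
                        (trans (sgn-sign (below (symDiff S S′) e) nothing) (sign-nothing (odd (below (symDiff S S′) e))))
      where
      e∈S = proj₁ (inDiff-true S S′ e e∈S∖S′)
      e∉R : mem e R ≡ false
      e∉R = trans (sym (trans (mem-setMem-other (remove q R) false e≢b) (mem-setMem-other R false e≢q)))
                  (proj₂ (inDiff-true S S′ e e∈S∖S′))
      φ≡0 : φ (remove e S) ≡ nothing
      φ≡0 = trans (φ-by-X S e e∈S) (trans (cong (sign (odd (below S e))) (vanish e e∈S e∉R)) (sign-nothing (odd (below S e))))

    cross : mulF F (X S q) (X R b) ≡ mulF F (X S b) (X R q)
    cross = null-signed-pair⇒≡ (odd (below S′ q) xor odd (below R b)) _ _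
      (subst₂ (λ u v → N (formal F (u ∷ v ∷ [])))
        (term q b q∉S′ (insert-remove-remove R q b q∈R (b≢q ∘ sym)) b∈R)
        (trans (term b q (mem-setMem (remove q R) b false) (insert-remove (remove q R) b b∈R∖q) q∈R)
               (cong (λ c → sign c (mulF F (X S b) (X R q))) signs-opposite))
        (N-perm (formal-two-points q b (b≢q ∘ sym) off-q-b)
                (rGP2′ S S′ hyper-S (remove-two-hypo hR a b b∈R b≢q) small)))

  cross-if-close : ∀ {S R j} a → IsHyper S → HyperAt R j →
                   (ys : List (El n)) → length ys ≤ 2 → (∀ e → inDiff S R e ≡ true → e ∈ ys) →
                   (∀ e → mem e S ≡ true → mem e R ≡ false → X S e ≡ nothing) →
                   ∀ e → mulF F (X S (j , a)) (X R e) ≡ mulF F (X S e) (X R (j , a))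
  cross-if-close {S} {R} {j} a hyper-S hR ys |ys|≤2 S∖R⊆ys vanish e with toSum (e ≟E (j , a)) | true-or-false (mem e R)
  ... | inj₁ refl | _        = refl
  ... | inj₂ e≢q  | inj₁ e∈R = TwoTermRelation.cross a e hyper-S hR e∈R e≢q small vanish
    where
    q : El n
    q = (j , a)
    small : countB (inDiff S (remove e (remove q R))) ≤ 4
    small = ≤-trans (countB-≤-length (q ∷ e ∷ ys) covered) (s≤s (s≤s |ys|≤2))
      where
      covered : ∀ d → inDiff S (remove e (remove q R)) d ≡ true → d ∈ q ∷ e ∷ ys
      covered d d∈S∖S′ with toSum (d ≟E q) | toSum (d ≟E e)
      ... | inj₁ d≡q | _         = here d≡q
      ... | inj₂ _   | inj₁ d≡e  = there (here d≡e)
      ... | inj₂ d≢q | inj₂ d≢e  = there (there (S∖R⊆ys d (trans (cong (λ c → mem d S ∧ not c) mem-R) d∈S∖S′)))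
        where mem-R = sym (trans (mem-setMem-other (remove q R) false d≢e) (mem-setMem-other R false d≢q))
  ... | inj₂ e≢q  | inj₂ e∉R = trans (cong (mulF F (X S (j , a))) (X-outside R e e∉R))
                                     (trans (mulF-nothingʳ (X S (j , a))) (cong (λ y → mulF F y (X R (j , a))) (sym XSe≡0)))
    where
    XSe≡0 : X S e ≡ nothing
    XSe≡0 with true-or-false (mem e S)
    ... | inj₁ e∈S = vanish e e∈S e∉R
    ... | inj₂ e∉S = X-outside S e e∉S

  ∝-if-close : ∀ {S R j} a → IsHyper S → HyperAt R j → X S (j , a) ≢ nothing → X R (j , a) ≢ nothing →
               (ys : List (El n)) → length ys ≤ 2 → (∀ e → inDiff S R e ≡ true → e ∈ ys) →
               (∀ e → mem e S ≡ true → mem e R ≡ false → X S e ≡ nothing) → X S ∝ X R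
  ∝-if-close {S} {R} {j} a hyper-S hR XSq≢0 XRq≢0 ys |ys|≤2 S∖R⊆ys vanish =
    ∝-by-cross (X S) (X R) (j , a) XSq≢0 XRq≢0 (cross-if-close a hyper-S hR ys |ys|≤2 S∖R⊆ys vanish)

  record ProportionalHyper (S : Sub n) (j : Fin n) (a : Bool) : Set where
    field
      set          : Sub n
      hyper        : HyperAt set j
      nonzero      : X set (j , a) ≢ nothing
      proportional : X S ∝ X set

  module MovePair {S₁ j₁} (hS₁ : HyperAt S₁ j₁) {s₁} (X₁≢0 : X S₁ (j₁ , s₁) ≢ nothing)
                  {j₂} (j₂≢j₁ : j₂ ≢ j₁) {s₂} (X₂≢0 : X S₁ (j₂ , s₂) ≢ nothing) where
    p₁ p₂ o : El n
    p₁ = (j₁ , s₁)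
    p₂ = (j₂ , s₂)
    o  = (j₁ , not s₁)

    S₁-at-j₂ : lookup S₁ j₂ ≡ single s₂
    S₁-at-j₂ = single-by-side s₂ (HyperAt.single-off hS₁ j₂ j₂≢j₁) (trans (sym (mem-lookup S₁ j₂ s₂)) (X≢0⇒mem S₁ p₂ X₂≢0))

    Y S₃ R₂ : Sub n
    Y  = remove o S₁
    S₃ = insert (j₂ , not s₂) Y
    R₂ = remove p₂ S₁

    S₃-at-j₂ : lookup S₃ j₂ ≡ both
    S₃-at-j₂ = lookup-insert-single Y (not s₂)
                 (trans (lookup-setMem-other S₁ (not s₁) false j₂≢j₁) (trans S₁-at-j₂ (cong single (sym (not-involutive s₂)))))

    S₃-at-j₁ : lookup S₃ j₁ ≡ single s₁
    S₃-at-j₁ = trans (lookup-setMem-other Y (not s₂) true (j₂≢j₁ ∘ sym))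
                 (trans (lookup-remove-both S₁ (not s₁) (HyperAt.pair-at hS₁)) (cong single (not-involutive s₁)))

    S₃-off : ∀ m → m ≢ j₁ → m ≢ j₂ → lookup S₃ m ≡ lookup S₁ m
    S₃-off m m≢j₁ m≢j₂ = trans (lookup-setMem-other Y (not s₂) true m≢j₂) (lookup-setMem-other S₁ (not s₁) false m≢j₁)

    hyper-S₃ : HyperAt S₃ j₂
    hyper-S₃ = record { pair-at = S₃-at-j₂ ; single-off = off }
      where
      off : ∀ m → m ≢ j₂ → IsSingle (lookup S₃ m)
      off m m≢j₂ with toSum (m ≟ j₁)
      ... | inj₁ refl = subst IsSingle (sym S₃-at-j₁) (single-isSingle s₁)
      ... | inj₂ m≢j₁ = subst IsSingle (sym (S₃-off m m≢j₁ m≢j₂)) (HyperAt.single-off hS₁ m m≢j₁)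

    aR₂ : AAt R₂ j₁ j₂
    aR₂ = remove-single-A s₂ hS₁ j₂≢j₁ S₁-at-j₂

    swapped : swapIn R₂ j₂ j₁ ≡ remove p₁ S₃
    swapped = ≡-by-lookup at
      where
      at : ∀ m → lookup (swapIn R₂ j₂ j₁) m ≡ lookup (remove p₁ S₃) m
      at m with toSum (m ≟ j₁) | toSum (m ≟ j₂)
      ... | inj₁ refl | _         = trans (lookup-≔ (R₂ [ j₂ ]≔ both) m neither) (sym (lookup-remove-single S₃ s₁ S₃-at-j₁))
      ... | inj₂ m≢j₁ | inj₁ refl = trans (lookup-≔-other (R₂ [ j₂ ]≔ both) neither m≢j₁)
                                      (trans (lookup-≔ R₂ m both) (sym (trans (lookup-setMem-other S₃ s₁ false m≢j₁) S₃-at-j₂)))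
      ... | inj₂ m≢j₁ | inj₂ m≢j₂ = trans (lookup-≔-other (R₂ [ j₂ ]≔ both) neither m≢j₁)
                                      (trans (lookup-≔-other R₂ both m≢j₂) (trans (lookup-setMem-other S₁ s₂ false m≢j₂)
                                        (sym (trans (lookup-setMem-other S₃ s₁ false m≢j₁) (S₃-off m m≢j₁ m≢j₂)))))

    X₃p₁≢0 : X S₃ p₁ ≢ nothing
    X₃p₁≢0 = φ≢0⇒X≢0 S₃ p₁ (trans (mem-by-lookup S₃ s₁ S₃-at-j₁) (side-single s₁))
               (subst (λ Z → φ Z ≢ nothing) swapped (proj₂ (swapIn-supported aR₂ (supported-A aR₂ (X≢0⇒φ≢0 S₁ p₂ X₂≢0)))))

    S₁∖S₃ : ∀ e → inDiff S₁ S₃ e ≡ true → e ≡ o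
    S₁∖S₃ (m , v) e∈S₁∖S₃ with toSum (m ≟ j₂) | toSum (m ≟ j₁)
    ... | inj₁ refl | _ with () ← trans (sym (proj₂ (inDiff-true S₁ S₃ (m , v) e∈S₁∖S₃)))
                                         (trans (mem-by-lookup S₃ v S₃-at-j₂) (side-both v))
    ... | inj₂ _    | inj₁ refl =
      cong (m ,_) (side-single-false s₁ (trans (sym (mem-by-lookup S₃ v S₃-at-j₁)) (proj₂ (inDiff-true S₁ S₃ (m , v) e∈S₁∖S₃))))
    ... | inj₂ m≢j₂ | inj₂ m≢j₁ with () ← trans (sym e∈S₁∖S₃) (inDiff-agree S₁ S₃ v (sym (S₃-off m m≢j₁ m≢j₂)))

    o-vanishes : X S₁ o ≡ nothing
    o-vanishes = ≡nothing-if-not-≢ (λ Xo≢0 → not-¬ refl (pair-side-unique hS₁ X₁≢0 Xo≢0))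

    vanish : ∀ e → mem e S₁ ≡ true → mem e S₃ ≡ false → X S₁ e ≡ nothing
    vanish e e∈S₁ e∉S₃ = subst (λ d → X S₁ d ≡ nothing) (sym (S₁∖S₃ e (cong₂ (λ a b → a ∧ not b) e∈S₁ e∉S₃))) o-vanishes

    covered : ∀ e → inDiff S₁ S₃ e ≡ true → e ∈ o ∷ []
    covered e e∈S₁∖S₃ = here (S₁∖S₃ e e∈S₁∖S₃)

    X₃p₂≢0 : X S₃ p₂ ≢ nothing
    X₃p₂≢0 X₃p₂≡0 = mulF-≢-nothing X₂≢0 X₃p₁≢0
      (trans (cross-if-close s₂ (HyperAt⇒IsHyper hS₁) hyper-S₃ (o ∷ []) (s≤s z≤n) covered vanish p₁)
             (trans (cong (mulF F (X S₁ p₁)) X₃p₂≡0) (mulF-nothingʳ (X S₁ p₁))))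

    result : ProportionalHyper S₁ j₂ s₂
    result = record
      { set          = S₃
      ; hyper        = hyper-S₃
      ; nonzero      = X₃p₂≢0
      ; proportional = ∝-if-close s₂ (HyperAt⇒IsHyper hS₁) hyper-S₃ X₂≢0 X₃p₂≢0 (o ∷ []) (s≤s z≤n) covered vanish
      }

  CloserTo : Sub n → Sub n → Fin n → Bool → Set
  CloserTo S₂ S j a = Σ (ProportionalHyper S j a) λ r → countB (inDiff (ProportionalHyper.set r) S₂) < countB (inDiff S S₂)

  -- Exchange at x between B₂ ∪ {x} and B ∖ {x}.  The partner (l , t) lies at a third index l, and
  -- pair-in-support for G then yields S₃: S with its entries at k and l replaced by those of S₂.
  module FlipStep {S S₂ j} (hS : HyperAt S j) (hS₂ : HyperAt S₂ j) {a} (XSp≢0 : X S (j , a) ≢ nothing)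
                  (XS₂p≢0 : X S₂ (j , a) ≢ nothing) (same : SameSupport (X S) (X S₂)) {k} (differ : lookup S k ≢ lookup S₂ k) where
    p : El n
    p = (j , a)

    k≢j : k ≢ j
    k≢j refl = differ (trans (HyperAt.pair-at hS) (sym (HyperAt.pair-at hS₂)))

    c : Bool
    c = proj₁ (single-view (HyperAt.single-off hS k k≢j))

    S-at-k : lookup S k ≡ single c
    S-at-k = proj₂ (single-view (HyperAt.single-off hS k k≢j))

    S₂-at-k : lookup S₂ k ≡ single (not c)
    S₂-at-k with single-view (HyperAt.single-off hS₂ k k≢j)
    ... | d , S₂k = trans S₂k (cong single (¬-not (λ d≡c → differ (trans S-at-k (sym (trans S₂k (cong single d≡c)))))))

    x x̄ : El n
    x = (k , c)
    x̄ = (k , not c)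

    B B₂ H H′ : Sub n
    B  = remove p S
    B₂ = remove p S₂
    H  = insert x B₂
    H′ = remove x B

    tB : IsTransversal B
    tB = remove-pair hS a

    B-off : ∀ m → m ≢ j → lookup B m ≡ lookup S m
    B-off m m≢j = lookup-setMem-other S a false m≢j

    B₂-off : ∀ m → m ≢ j → lookup B₂ m ≡ lookup S₂ m
    B₂-off m m≢j = lookup-setMem-other S₂ a false m≢j

    B-at-k : lookup B k ≡ single c
    B-at-k = trans (B-off k k≢j) S-at-k

    B₂-at-k : lookup B₂ k ≡ single (not c)
    B₂-at-k = trans (B₂-off k k≢j) S₂-at-k

    H-off : ∀ m → m ≢ k → lookup H m ≡ lookup B₂ m
    H-off m m≢k = lookup-setMem-other B₂ c true m≢k

    H′-off : ∀ m → m ≢ k → lookup H′ m ≡ lookup B m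
    H′-off m m≢k = lookup-setMem-other B c false m≢k

    H′-at-k : lookup H′ k ≡ neither
    H′-at-k = lookup-remove-single B c B-at-k

    sB : Supported B
    sB = supported-transversal tB (X≢0⇒φ≢0 S p XSp≢0)

    same-side-only : ∀ {t} → (k , t) ≢ x → ¬ Supported (insert (k , t) H′)
    same-side-only {t} f≢x sZ = f≢x (cong (k ,_) (single-injective (begin
      single t                  ≡⟨ sym (lookup-insert-neither H′ t H′-at-k) ⟩
      lookup (insert (k , t) H′) k ≡⟨ supported-transversals-agree k sZ sB (insert-hole (remove-hypo c tB B-at-k) t) tB agree ⟩
      lookup B k                ≡⟨ B-at-k ⟩
      single c                  ∎)))
      where
      open ≡-Reasoning
      agree : ∀ m → m ≢ k → lookup (insert (k , t) H′) m ≡ lookup B m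
      agree m m≢k = trans (lookup-setMem-other H′ t true m≢k) (H′-off m m≢k)

    module Found {l t} (l≢k : l ≢ k) (l≢j : l ≢ j) (f∈H∖H′ : inDiff H H′ (l , t) ≡ true)
                 (sΑ : Supported (insert (l , t) H′)) where
      k≢l : k ≢ l
      k≢l = l≢k ∘ sym

      S₂-at-l : lookup S₂ l ≡ single t
      S₂-at-l = single-by-side t (HyperAt.single-off hS₂ l l≢j)
        (trans (sym (mem-lookup S₂ l t)) (trans (sym (mem-agree H S₂ t (trans (H-off l l≢k) (B₂-off l l≢j))))
                                                 (proj₁ (inDiff-true H H′ (l , t) f∈H∖H′))))

      B-at-l : lookup B l ≡ single (not t)
      B-at-l = trans (B-off l l≢j) (single-by-side-false t (HyperAt.single-off hS l l≢j)
        (trans (sym (mem-lookup S l t)) (trans (sym (mem-agree H′ S t (trans (H′-off l l≢k) (B-off l l≢j))))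
                                               (proj₂ (inDiff-true H H′ (l , t) f∈H∖H′)))))

      Α G B₃ S₃ : Sub n
      Α  = insert (l , t) H′
      G  = insert x̄ Α
      B₃ = remove (l , not t) G
      S₃ = insert p B₃

      Α-at-k : lookup Α k ≡ neither
      Α-at-k = trans (lookup-setMem-other H′ t true k≢l) H′-at-k

      G-at-k : lookup G k ≡ single (not c)
      G-at-k = lookup-insert-neither Α (not c) Α-at-k

      G-at-l : lookup G l ≡ both
      G-at-l = trans (lookup-setMem-other Α (not c) true l≢k) (lookup-insert-single H′ t (trans (H′-off l l≢k) B-at-l))

      G-off : ∀ m → m ≢ l → m ≢ k → lookup G m ≡ lookup B m
      G-off m m≢l m≢k = trans (lookup-setMem-other Α (not c) true m≢k) (trans (lookup-setMem-other H′ t true m≢l) (H′-off m m≢k))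

      hyper-G : HyperAt G l
      hyper-G = record { pair-at = G-at-l ; single-off = off }
        where
        off : ∀ m → m ≢ l → IsSingle (lookup G m)
        off m m≢l with toSum (m ≟ k)
        ... | inj₁ refl = subst IsSingle (sym G-at-k) (single-isSingle (not c))
        ... | inj₂ m≢k  = subst IsSingle (sym (G-off m m≢l m≢k)) (tB m)

      XGx̄≢0 : X G x̄ ≢ nothing
      XGx̄≢0 = φ≢0⇒X≢0 G x̄ (mem-setMem Α x̄ true)
                (subst (λ Z → φ Z ≢ nothing) (sym (remove-insert Α x̄ (trans (mem-by-lookup Α (not c) Α-at-k) (side-neither (not c)))))
                       (proj₂ sΑ))

      same-side-vanishes : X G (l , t) ≡ nothing
      same-side-vanishes = ≡nothing-if-not-≢ λ X≢0 → single-not-≢ c (begin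
        single (not c)              ≡⟨ sym (trans (lookup-setMem-other G t false k≢l) G-at-k) ⟩
        lookup (remove (l , t) G) k ≡⟨ supported-transversals-agree k (supported-transversal (remove-pair hyper-G t) (X≢0⇒φ≢0 G (l , t) X≢0))
                                         sB (remove-pair hyper-G t) tB agree ⟩
        lookup B k                  ≡⟨ B-at-k ⟩
        single c                    ∎)
        where
        open ≡-Reasoning
        agree : ∀ m → m ≢ k → lookup (remove (l , t) G) m ≡ lookup B m
        agree m m≢k with toSum (m ≟ l)
        ... | inj₁ refl = trans (lookup-remove-both G t G-at-l) (sym B-at-l)
        ... | inj₂ m≢l  = trans (lookup-setMem-other G t false m≢l) (G-off m m≢l m≢k)

      other-side : X G (l , not t) ≢ nothing
      other-side with pair-in-support hyper-G x̄ XGx̄≢0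
      ... | u , XGu≢0 with u Bool.≟ t
      ...   | yes refl = ⊥-elim (XGu≢0 same-side-vanishes)
      ...   | no u≢t   = subst (λ v → X G (l , v) ≢ nothing) (¬-not u≢t) XGu≢0

      B₃-off : ∀ m → m ≢ l → m ≢ k → lookup B₃ m ≡ lookup B m
      B₃-off m m≢l m≢k = trans (lookup-setMem-other G (not t) false m≢l) (G-off m m≢l m≢k)

      B₃-at-j : lookup B₃ j ≡ single (not a)
      B₃-at-j = trans (B₃-off j (l≢j ∘ sym) (k≢j ∘ sym)) (lookup-remove-both S a (HyperAt.pair-at hS))

      S₃-at-k : lookup S₃ k ≡ lookup S₂ k
      S₃-at-k = trans (lookup-setMem-other B₃ a true k≢j) (trans (lookup-setMem-other G (not t) false k≢l) (trans G-at-k (sym S₂-at-k)))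

      S₃-at-l : lookup S₃ l ≡ lookup S₂ l
      S₃-at-l = trans (lookup-setMem-other B₃ a true l≢j)
                  (trans (lookup-remove-both G (not t) G-at-l) (trans (cong single (not-involutive t)) (sym S₂-at-l)))

      S₃-off : ∀ m → m ≢ k → m ≢ l → lookup S₃ m ≡ lookup S m
      S₃-off m m≢k m≢l with toSum (m ≟ j)
      ... | inj₁ refl = trans (lookup-insert-single B₃ a B₃-at-j) (sym (HyperAt.pair-at hS))
      ... | inj₂ m≢j  = trans (lookup-setMem-other B₃ a true m≢j) (trans (B₃-off m m≢l m≢k) (B-off m m≢j))

      S₃-agrees : ∀ m → lookup S₃ m ≡ lookup S₂ m ⊎ lookup S₃ m ≡ lookup S m
      S₃-agrees m with toSum (m ≟ k) | toSum (m ≟ l)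
      ... | inj₁ refl | _         = inj₁ S₃-at-k
      ... | inj₂ _    | inj₁ refl = inj₁ S₃-at-l
      ... | inj₂ m≢k  | inj₂ m≢l  = inj₂ (S₃-off m m≢k m≢l)

      hyper-S₃ : HyperAt S₃ j
      hyper-S₃ = insert-hyper a (remove-pair hyper-G (not t)) B₃-at-j

      XS₃p≢0 : X S₃ p ≢ nothing
      XS₃p≢0 = φ≢0⇒X≢0 S₃ p (mem-setMem B₃ p true)
                 (subst (λ Z → φ Z ≢ nothing) (sym (remove-insert B₃ p (trans (mem-by-lookup B₃ a B₃-at-j) (side-single-not a))))
                        (X≢0⇒φ≢0 G (l , not t) other-side))

      S∖S₃⊆S∖S₂ : ∀ e → mem e S ≡ true → mem e S₃ ≡ false → mem e S₂ ≡ false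
      S∖S₃⊆S∖S₂ (m , v) e∈S e∉S₃ with S₃-agrees m
      ... | inj₁ agree₂ = trans (sym (mem-agree S₃ S₂ v agree₂)) e∉S₃
      ... | inj₂ agree  with () ← trans (sym e∉S₃) (trans (mem-agree S₃ S v agree) e∈S)

      covered : ∀ e → inDiff S S₃ e ≡ true → e ∈ x ∷ (l , not t) ∷ []
      covered (m , v) e∈S∖S₃ with toSum (m ≟ k) | toSum (m ≟ l)
      ... | inj₁ refl | _         = here (cong (m ,_) (side-single-true c (trans (sym (mem-by-lookup S v S-at-k)) e∈S)))
        where e∈S = proj₁ (inDiff-true S S₃ (m , v) e∈S∖S₃)
      ... | inj₂ _    | inj₁ refl = there (here (cong (m ,_) (side-single-true (not t) (trans (sym (mem-by-lookup S v S-at-l)) e∈S))))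
        where
        e∈S = proj₁ (inDiff-true S S₃ (m , v) e∈S∖S₃)
        S-at-l : lookup S m ≡ single (not t)
        S-at-l = trans (sym (B-off m l≢j)) B-at-l
      ... | inj₂ m≢k  | inj₂ m≢l  with () ← trans (sym e∈S∖S₃) (inDiff-agree S S₃ v (sym (S₃-off m m≢k m≢l)))

      closer : countB (inDiff S₃ S₂) < countB (inDiff S S₂)
      closer = countB-< x S₃∖S₂⊆S∖S₂ (inDiff-agree S₃ S₂ c S₃-at-k)
                 (cong₂ (λ u w → u ∧ not w) (trans (mem-by-lookup S c S-at-k) (side-single c))
                                            (trans (mem-by-lookup S₂ c S₂-at-k) (side-single-not c)))
        where
        S₃∖S₂⊆S∖S₂ : ∀ e → inDiff S₃ S₂ e ≡ true → inDiff S S₂ e ≡ true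
        S₃∖S₂⊆S∖S₂ (m , v) d with S₃-agrees m
        ... | inj₁ agree₂ with () ← trans (sym d) (inDiff-agree S₃ S₂ v agree₂)
        ... | inj₂ agree  = trans (cong (_∧ not (mem (m , v) S₂)) (sym (mem-agree S₃ S v agree))) d

      result : CloserTo S₂ S j a
      result = record
        { set          = S₃
        ; hyper        = hyper-S₃
        ; nonzero      = XS₃p≢0
        ; proportional = ∝-if-close a (HyperAt⇒IsHyper hS) hyper-S₃ XSp≢0 XS₃p≢0 (x ∷ (l , not t) ∷ []) ≤-refl covered vanish
        } , closer
        where
        vanish : ∀ e → mem e S ≡ true → mem e S₃ ≡ false → X S e ≡ nothing
        vanish e e∈S e∉S₃ = proj₂ (same e) (X-outside S₂ e (S∖S₃⊆S∖S₂ e e∈S e∉S₃))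

    step : ∀ f → f ≢ x → inDiff H H′ f ≡ true → Supported (remove f H) → Supported (insert f H′) → CloserTo S₂ S j a
    step (l , t) f≢x f∈H∖H′ _ sI with toSum (l ≟ k) | toSum (l ≟ j)
    ... | inj₁ refl | _         = ⊥-elim (same-side-only f≢x sI)
    ... | inj₂ l≢k  | inj₁ refl with () ← trans (sym f∈H∖H′) (inDiff-agree H H′ t
                                     (trans (H-off l l≢k) (trans (lookup-remove-both S₂ a (HyperAt.pair-at hS₂))
                                       (sym (trans (H′-off l l≢k) (lookup-remove-both S a (HyperAt.pair-at hS)))))))
    ... | inj₂ l≢k  | inj₂ l≢j  = Found.result {l} {t} l≢k l≢j f∈H∖H′ sI

    result : CloserTo S₂ S j a
    result with exchange H H′ (HyperAt⇒IsHyper (insert-hyper c (remove-pair hS₂ a) B₂-at-k))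
                              (HypoAt⇒IsHypo (remove-hypo c tB B-at-k)) x
                  (cong₂ (λ u w → u ∧ not w) (mem-setMem B₂ x true) (mem-setMem B x false))
                  (subst Supported (sym (remove-insert B₂ x (trans (mem-by-lookup B₂ c B₂-at-k) (side-single-not c))))
                         (supported-transversal (remove-pair hS₂ a) (X≢0⇒φ≢0 S₂ p XS₂p≢0)))
                  (subst Supported (sym (insert-remove B x (trans (mem-by-lookup B c B-at-k) (side-single c)))) sB)
    ... | f , f≢x , f∈H∖H′ , sR , sI = step f f≢x f∈H∖H′ sR sI

  same-pair-∝ : ∀ {S S₂ j a} → HyperAt S j → HyperAt S₂ j → X S (j , a) ≢ nothing → X S₂ (j , a) ≢ nothing →
                SameSupport (X S) (X S₂) → X S ∝ X S₂
  same-pair-∝ {S} {S₂} = go (<-wellFounded (countB (inDiff S S₂)))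
    where
    go : ∀ {S j a} → Acc _<_ (countB (inDiff S S₂)) → HyperAt S j → HyperAt S₂ j → X S (j , a) ≢ nothing →
         X S₂ (j , a) ≢ nothing → SameSupport (X S) (X S₂) → X S ∝ X S₂
    go {S} (acc smaller) hS hS₂ XS≢0 XS₂≢0 same with ≡-or-differ S S₂
    ... | inj₁ refl = ∝-refl (X S)
    ... | inj₂ (k , differ) with FlipStep.result hS hS₂ XS≢0 XS₂≢0 same differ
    ...   | r , closer = ∝-trans (proportional r)
                           (go (smaller closer) (hyper r) hS₂ (nonzero r) XS₂≢0 (∝-sameSupport (proportional r) same))
      where open ProportionalHyper

  pair-nonzero-or-X≡0 : ∀ {S j} → HyperAt S j → (∃[ a ] X S (j , a) ≢ nothing) ⊎ (∀ e → X S e ≡ nothing)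
  pair-nonzero-or-X≡0 {S} {j} hS with nothing-or-≢ (X S (j , false)) | nothing-or-≢ (X S (j , true))
  ... | inj₂ X₀≢0 | _         = inj₁ (false , X₀≢0)
  ... | inj₁ _    | inj₂ X₁≢0 = inj₁ (true , X₁≢0)
  ... | inj₁ X₀≡0 | inj₁ X₁≡0 = inj₂ λ e → ≡nothing-if-not-≢ λ Xe≢0 → pair-zero (pair-in-support hS e Xe≢0)
    where
    pair-zero : ¬ (∃[ a ] X S (j , a) ≢ nothing)
    pair-zero (false , X≢0) = X≢0 X₀≡0
    pair-zero (true  , X≢0) = X≢0 X₁≡0

  relocate : ∀ {S j₁ s₁ j₂ s₂} → HyperAt S j₁ → X S (j₁ , s₁) ≢ nothing → X S (j₂ , s₂) ≢ nothing → ProportionalHyper S j₂ s₂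
  relocate {S} {j₁} {j₂ = j₂} hS X₁≢0 X₂≢0 with toSum (j₂ ≟ j₁)
  ... | inj₁ refl  = record { set = S ; hyper = hS ; nonzero = X₂≢0 ; proportional = ∝-refl (X S) }
  ... | inj₂ j₂≢j₁ = MovePair.result hS X₁≢0 j₂≢j₁ X₂≢0

  ∝-if-same-support : ∀ {S₁ S₂} → IsHyper S₁ → IsHyper S₂ → SameSupport (X S₁) (X S₂) → X S₁ ∝ X S₂
  ∝-if-same-support {S₁} {S₂} h₁ h₂ same with IsHyper⇒HyperAt h₁ | IsHyper⇒HyperAt h₂
  ... | j₁ , hS₁ | j₂ , hS₂ with pair-nonzero-or-X≡0 hS₂
  ...   | inj₂ X₂≡0 = Tract.one F , λ e → trans (proj₂ (same e) (X₂≡0 e)) (cong (scaleF F (Tract.one F)) (sym (X₂≡0 e)))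
  ...   | inj₁ (s₂ , X₂≢0) with pair-in-support hS₁ (j₂ , s₂) (λ X₁≡0 → X₂≢0 (proj₁ (same (j₂ , s₂)) X₁≡0))
  ...     | s₁ , X₁≢0 =
    ∝-trans (proportional r) (same-pair-∝ (hyper r) hS₂ (nonzero r) X₂≢0 (∝-sameSupport (proportional r) same))
    where
    open ProportionalHyper
    r : ProportionalHyper S₁ j₂ s₂
    r = relocate hS₁ X₁≢0 (λ X₁≡0 → X₂≢0 (proj₁ (same (j₂ , s₂)) X₁≡0))

lemma4p25 : (F : Tract) (n : ℕ) (φ : Sub n → Elt F) → IsWeakRestrictedGP F n φ →
    ∀ S₁ S₂ → IsHyper S₁ → IsHyper S₂ →
    (∀ e → (Xvec F φ S₁ e ≡ nothing → Xvec F φ S₂ e ≡ nothing) × (Xvec F φ S₂ e ≡ nothing → Xvec F φ S₁ e ≡ nothing)) →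
    ∃[ α ] (∀ e → Xvec F φ S₁ e ≡ scaleF F α (Xvec F φ S₂ e))
lemma4p25 F n φ gp S₁ S₂ = GrassmannPlücker.∝-if-same-support F n φ gp
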